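{- For every positive integer $n$, each of the following statistics on $S_n$ is homomesic with respect to the reverse map $\mathcal{R}$ and also homomesic with respect to the complement map $\mathcal{C}$: (1) the number of inversions; (2) the inversion sum; (3) the number of non-inversions; (4) the non-inversion sum; (5) the number of inversions of distance at most $3$; (6) the number of inversions of distance at most $2$; (7) the number of even inversions; (8) the number of odd inversions; (9) the standardized bi-alternating inversion number; (10) the number of descents; (11) the number of ascents; (12) the number of runs; (13) the number of cyclic descents; (14) the number of descents of distance $2$; (15) the number of ascents of distance $2$; (16) the number of strict $3$-descents; (17) the width of the permutation tree; (18) the cosine; (19) the number of recoils; (20) the total number of occurrences of the patterns $132$, $213$ and $321$; (21) the number of descents plus the number of recoils; (22) Spearman's rho with the identity.
   Context: Homomesy: given a finite set $S$, a bijection $\mathcal{X}:S\to S$ and $f:S\to\mathbb{Z}$, $f$ is homomesic if there is a constant $c$ such that for every orbit $\mathcal{O}$ of $\mathcal{X}$, $\frac{1}{|\mathcal{O}|}\sum_{x\in\mathcal{O}}f(x)=c$. For $\sigma=\sigma_1\cdots\sigma_n\in S_n$ (one-line notation): $\mathcal{R}(\sigma)_i=\sigma_{n+1-i}$ and $\mathcal{C}(\sigma)_i=n+1-\sigma_i$. An inversion is a pair of positions $(i,j)$, $i<j$, $\sigma_i>\sigma_j$; a non-inversion is a pair $i<j$ with $\sigma_i<\sigma_j$. It has distance $j-i$; it is even if $i\equiv j\pmod 2$ and odd otherwise. The inversion sum is $\sum_{(a,b)\text{ inversion}}(b-a)$, the non-inversion sum is $\sum_{(a,b)\text{ non-inversion}}(b-a)$.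 With $j(\sigma)=\sum_{1\le y<x\le n}(-1)^{x+y}\mathrm{sign}(\sigma_x-\sigma_y)$, the standardized bi-alternating inversion number is $(j(\sigma)+\lfloor n/2\rfloor^2)/2$. A descent is $i\in[n-1]$ with $\sigma_i>\sigma_{i+1}$, an ascent otherwise. A run is a maximal contiguous increasing subsequence. The number of cyclic descents is the number of descents plus $1$ if $\sigma_n<\sigma_1$. A descent of distance $2$ is $i\in[n-2]$ with $\sigma_i>\sigma_{i+2}$ (otherwise an ascent of distance $2$); a strict $3$-descent is $i\in[n-3]$ with $\sigma_i>\sigma_{i+3}$. The permutation tree of $\sigma$ is the rooted tree on $\{0,\dots,n\}$ with root $0$ where $\sigma_1$ is a child of the root and $\sigma_{i+1}$ is attached as a child of the first node smaller than $\sigma_{i+1}$ on the path from $\sigma_i$ to the root; its width is its number of leaves. The cosine is $\sum_{i=1}^n i\sigma_i$. A recoil is a value $i\in[n-1]$ such that $i+1$ appears to the left of $i$ in $\sigma$ (equivalently a descent of $\sigma^{ -1}$). An occurrence of a pattern $abc$ is a triple of positions $i_1<i_2<i_3$ with $\sigma_{i_1}\sigma_{i_2}\sigma_{i_3}$ in the same relative order as $abc$. Spearman's rho with the identity is $\sum_{i=1}^n(\sigma_i-i)^2$. -}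

module Defs where

open import Data.Bool using (Bool; true; false; not; _∧_; _∨_; if_then_else_)
open import Data.Nat as ℕ using (ℕ; zero; suc; _+_; _*_; _∸_; _≤_; _<_; _<ᵇ_; _≤ᵇ_; _≡ᵇ_)
open import Data.Nat.DivMod using (_/_)
open import Data.Integer as ℤ using (ℤ; +_)
open import Data.Integer.DivMod using (_/ℕ_)
open import Data.Rational as ℚ using (ℚ)
open import Data.List using (List; []; _∷_; map; filter; length; upTo; reverse; foldr; cartesianProduct; dropWhile; concatMap)
open import Data.List.Relation.Binary.Permutation.Propositional using (_↭_)
open import Data.Product using (Σ; _×_; _,_; proj₁; proj₂)
open import Relation.Binary.PropositionalEquality using (_≡_; _≢_)

iter : {A : Set} → (A → A) → ℕ → A → A
iter X zero    x = x
iter X (suc k) x = X (iter X k x)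

OrbitSize : {A : Set} → (A → A) → A → ℕ → Set
OrbitSize X x k = (1 ≤ k) × (iter X k x ≡ x) × (∀ j → 1 ≤ j → j < k → iter X j x ≢ x)

sumℤ : List ℤ → ℤ
sumℤ = foldr ℤ._+_ (+ 0)

orbitSum : {A : Set} → (A → A) → (A → ℤ) → A → ℕ → ℤ
orbitSum X f x k = sumℤ (map (λ i → f (iter X i x)) (upTo k))

Homomesic : {A : Set} → (A → Set) → (A → A) → (A → ℤ) → Set
Homomesic S X f =
  Σ ℚ λ c → ∀ x → S x → ∀ m → OrbitSize X x (suc m) →
    (orbitSum X f x (suc m) ℚ./ suc m) ≡ c

-- Permutations in one-line notation: lists of values 1..n

oneTo : ℕ → List ℕ
oneTo n = map suc (upTo n)

Perm : ℕ → List ℕ → Set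
Perm n σ = σ ↭ oneTo n

revMap : List ℕ → List ℕ
revMap = reverse

compMap : ℕ → List ℕ → List ℕ
compMap n = map (λ v → suc n ∸ v)

-- σ_i, positions 1-indexed (0 outside range)
at : List ℕ → ℕ → ℕ
at []       _             = 0
at (x ∷ xs) zero          = 0
at (x ∷ xs) (suc zero)    = x
at (x ∷ xs) (suc (suc i)) = at xs (suc i)

-- position (1-indexed) of value v in σ (0 if absent)
posOf : List ℕ → ℕ → ℕ
posOf []       v = 0
posOf (x ∷ xs) v = if x ≡ᵇ v then 1 else (if posOf xs v ≡ᵇ 0 then 0 else suc (posOf xs v))

countB : {A : Set} → (A → Bool) → List A → ℕ
countB p xs = length (filter (λ a → Data.Bool._≟_ (p a) true) xs)
  where import Data.Bool

sumN : List ℕ → ℕ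
sumN = foldr _+_ 0

isEven : ℕ → Bool
isEven zero          = true
isEven (suc zero)    = false
isEven (suc (suc n)) = isEven n

posPairs : ℕ → List (ℕ × ℕ)
posPairs n = filter (λ p → proj₁ p ℕ.<? proj₂ p) (cartesianProduct (oneTo n) (oneTo n))

posTriples : ℕ → List (ℕ × ℕ × ℕ)
posTriples n =
  filter (λ t → proj₁ t ℕ.<? proj₁ (proj₂ t))
    (concatMap (λ p → map (λ k → proj₁ p , proj₂ p , k)
                          (filter (λ k → proj₂ p ℕ.<? k) (oneTo n)))
               (posPairs n))

isInv : List ℕ → ℕ × ℕ → Bool
isInv σ (i , j) = at σ j <ᵇ at σ i

isNonInv : List ℕ → ℕ × ℕ → Bool
isNonInv σ (i , j) = at σ i <ᵇ at σ j

dist : ℕ × ℕ → ℕ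
dist (i , j) = j ∸ i

inversions : List ℕ → ℤ
inversions σ = + countB (isInv σ) (posPairs (length σ))

inversionSum : List ℕ → ℤ
inversionSum σ = + sumN (map dist (filter (λ p → Data.Bool._≟_ (isInv σ p) true) (posPairs (length σ))))
  where import Data.Bool

nonInversions : List ℕ → ℤ
nonInversions σ = + countB (isNonInv σ) (posPairs (length σ))

nonInversionSum : List ℕ → ℤ
nonInversionSum σ = + sumN (map dist (filter (λ p → Data.Bool._≟_ (isNonInv σ p) true) (posPairs (length σ))))
  where import Data.Bool

inversionsDist≤3 : List ℕ → ℤ
inversionsDist≤3 σ = + countB (λ p → isInv σ p ∧ (dist p ≤ᵇ 3)) (posPairs (length σ))

inversionsDist≤2 : List ℕ → ℤ
inversionsDist≤2 σ = + countB (λ p → isInv σ p ∧ (dist p ≤ᵇ 2)) (posPairs (length σ))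

evenInversions : List ℕ → ℤ
evenInversions σ = + countB (λ p → isInv σ p ∧ isEven (dist p)) (posPairs (length σ))

oddInversions : List ℕ → ℤ
oddInversions σ = + countB (λ p → isInv σ p ∧ not (isEven (dist p))) (posPairs (length σ))

signℤ : ℕ → ℕ → ℤ
signℤ a b = if b <ᵇ a then + 1 else (if a <ᵇ b then ℤ.- + 1 else + 0)

altSign : ℕ → ℤ
altSign k = if isEven k then + 1 else ℤ.- + 1

jStat : List ℕ → ℤ
jStat σ = sumℤ (map (λ p → altSign (proj₁ p + proj₂ p) ℤ.* signℤ (at σ (proj₂ p)) (at σ (proj₁ p)))
                    (posPairs (length σ)))

biAltInversions : List ℕ → ℤ
biAltInversions σ = (jStat σ ℤ.+ + ((length σ / 2) * (length σ / 2))) /ℕ 2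

descentsAt : ℕ → List ℕ → ℕ
descentsAt d σ = countB (λ i → at σ (i + d) <ᵇ at σ i) (oneTo (length σ ∸ d))

ascentsAt : ℕ → List ℕ → ℕ
ascentsAt d σ = countB (λ i → not (at σ (i + d) <ᵇ at σ i)) (oneTo (length σ ∸ d))

descents : List ℕ → ℤ
descents σ = + descentsAt 1 σ

ascents : List ℕ → ℤ
ascents σ = + ascentsAt 1 σ

consHead : ℕ → List (List ℕ) → List (List ℕ)
consHead x []       = (x ∷ []) ∷ []
consHead x (r ∷ rs) = (x ∷ r) ∷ rs

runsOf : List ℕ → List (List ℕ)
runsOf []           = []
runsOf (x ∷ [])     = (x ∷ []) ∷ []
runsOf (x ∷ y ∷ zs) = if x <ᵇ y then consHead x (runsOf (y ∷ zs))
                                else (x ∷ []) ∷ runsOf (y ∷ zs)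

runs : List ℕ → ℤ
runs σ = + length (runsOf σ)

cyclicDescents : List ℕ → ℤ
cyclicDescents σ = + (descentsAt 1 σ + (if at σ (length σ) <ᵇ at σ 1 then 1 else 0))

descentsDist2 : List ℕ → ℤ
descentsDist2 σ = + descentsAt 2 σ

ascentsDist2 : List ℕ → ℤ
ascentsDist2 σ = + ascentsAt 2 σ

strict3Descents : List ℕ → ℤ
strict3Descents σ = + descentsAt 3 σ

-- (17) permutation tree: edges (child , parent). The stack is the path
-- from the last inserted node σ_i to the root 0 (top first).
treeEdges : List ℕ → List ℕ → List (ℕ × ℕ)
treeEdges stack []       = []
treeEdges stack (x ∷ xs) with dropWhile (λ v → x ℕ.≤? v) stack
... | []         = []          -- unreachable: 0 is always on the stack
... | p ∷ rest   = (x , p) ∷ treeEdges (x ∷ p ∷ rest) xs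

permTreeEdges : List ℕ → List (ℕ × ℕ)
permTreeEdges σ = treeEdges (0 ∷ []) σ

hasChild : List (ℕ × ℕ) → ℕ → Bool
hasChild es v = foldr (λ e b → (proj₂ e ≡ᵇ v) ∨ b) false es

-- width = number of leaves among the nodes 0..n
treeWidth : List ℕ → ℤ
treeWidth σ = + countB (λ v → not (hasChild (permTreeEdges σ) v)) (upTo (suc (length σ)))

cosine : List ℕ → ℤ
cosine σ = + sumN (map (λ i → i * at σ i) (oneTo (length σ)))

recoilsN : List ℕ → ℕ
recoilsN σ = countB (λ i → posOf σ (suc i) <ᵇ posOf σ i) (oneTo (length σ ∸ 1))

recoils : List ℕ → ℤ
recoils σ = + recoilsN σ

_⇔ᵇ_ : Bool → Bool → Bool
true  ⇔ᵇ b = b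
false ⇔ᵇ b = not b

sameOrder : ℕ × ℕ × ℕ → ℕ × ℕ × ℕ → Bool
sameOrder (a , b , c) (x , y , z) =
  ((a <ᵇ b) ⇔ᵇ (x <ᵇ y)) ∧ ((a <ᵇ c) ⇔ᵇ (x <ᵇ z)) ∧ ((b <ᵇ c) ⇔ᵇ (y <ᵇ z))

occurrences : ℕ × ℕ × ℕ → List ℕ → ℕ
occurrences pat σ =
  countB (λ t → sameOrder (at σ (proj₁ t) , at σ (proj₁ (proj₂ t)) , at σ (proj₂ (proj₂ t))) pat)
         (posTriples (length σ))

patterns132-213-321 : List ℕ → ℤ
patterns132-213-321 σ =
  + (occurrences (1 , 3 , 2) σ + occurrences (2 , 1 , 3) σ + occurrences (3 , 2 , 1) σ)

descentsPlusRecoils : List ℕ → ℤ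
descentsPlusRecoils σ = + (descentsAt 1 σ + recoilsN σ)

spearmanRho : List ℕ → ℤ
spearmanRho σ = sumℤ (map (λ i → (+ at σ i ℤ.- + i) ℤ.* (+ at σ i ℤ.- + i)) (oneTo (length σ)))

statistics : List (List ℕ → ℤ)
statistics =
  inversions ∷ inversionSum ∷ nonInversions ∷ nonInversionSum ∷
  inversionsDist≤3 ∷ inversionsDist≤2 ∷ evenInversions ∷ oddInversions ∷
  biAltInversions ∷ descents ∷ ascents ∷ runs ∷ cyclicDescents ∷
  descentsDist2 ∷ ascentsDist2 ∷ strict3Descents ∷ treeWidth ∷ cosine ∷
  recoils ∷ patterns132-213-321 ∷ descentsPlusRecoils ∷ spearmanRho ∷ []

-- Both ℛ and 𝒞 are involutions, so every orbit has one or two elements and f is homomesic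
-- as soon as f σ + f (X σ) takes one value K on all of S_n (every orbit then averages K/2).
-- For the statistics counting pairs of positions this holds because, for distinct values,
-- ℛ and 𝒞 turn a counted pair into an uncounted one and vice versa; likewise for
-- d-descents and recoils, and for triples because ℛ and 𝒞 exchange the patterns
-- 132, 213, 321 with 123, 231, 312.  Runs, tree width and ascents are affine in descents
-- on S_n, and cyclic descents add one balanced comparison of σₙ with σ₁.  For the cosine,
-- Σ i σᵢ + Σ i (n+1-σᵢ) and Σ i σᵢ + Σ (n+1-i) σᵢ do not depend on σ, and Spearman's rho
-- is affine in the cosine.

module Submission where

open import Defs
open import Data.Bool using (Bool; true; false; not; _∧_; _∨_; if_then_else_; T)
import Data.Bool
open import Data.Empty using (⊥-elim)
open import Data.Unit using (tt)
open import Function using (_∘_)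
open import Data.Nat as ℕ using (ℕ; zero; suc; _+_; _*_; _∸_; _≤_; _<_; _<ᵇ_; _≤ᵇ_; _≡ᵇ_; z≤n; s≤s)
open import Data.Nat.Properties
open import Data.Nat.DivMod using (m/n≡1+[m∸n]/n)
open import Data.Nat.ListAction.Properties using (sum-↭)
open import Data.Nat.Tactic.RingSolver using (solve-∀)
open import Data.Integer as ℤ using (ℤ; +_; -[1+_]; _/ℕ_)
import Data.Integer.Properties as ℤP
import Data.Integer.Tactic.RingSolver as ℤ-Solver
open import Data.Rational as ℚ using (ℚ)
import Data.Rational.Properties as ℚP
open import Data.Rational.Unnormalised using (mkℚᵘ; *≡*)
open import Data.List using (List; []; _∷_; map; filter; length; upTo; applyUpTo; reverse; cartesianProduct; concatMap; dropWhile; _++_; [_])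
open import Data.List.Properties using (map-upTo; upTo-∷ʳ; map-++; map-∘; length-map; length-upTo; length-reverse; unfold-reverse; reverse-++; reverse-involutive)
open import Data.List.Membership.Propositional using (_∈_; _∉_)
open import Data.List.Membership.Propositional.Properties using (∈-map⁺; ∈-map⁻; ∈-upTo⁺; ∈-upTo⁻; ∈-filter⁻; ∈-cartesianProduct⁻; ∈-++⁺ˡ; ∈-++⁺ʳ)
open import Data.List.Relation.Unary.Any using (here; there)
open import Data.List.Relation.Unary.All as All using (All; []; _∷_)
open import Data.List.Relation.Unary.AllPairs using ([]; _∷_)
open import Data.List.Relation.Unary.Unique.Propositional using (Unique)
import Data.List.Relation.Unary.Unique.Propositional.Properties as Unique
open import Data.List.Relation.Binary.Permutation.Propositional as ↭ using (_↭_; ↭-sym; ↭-trans; ↭-reflexive)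
open import Data.List.Relation.Binary.Permutation.Propositional.Properties using (∈-resp-↭; All-resp-↭; ↭-length; ↭-reverse; map⁺)
open import Data.Product using (_×_; _,_; proj₁; proj₂)
open import Data.Sum using (inj₁; inj₂)
open import Relation.Binary using (tri<; tri≈; tri>)
open import Relation.Binary.PropositionalEquality hiding ([_])
open import Relation.Nullary using (¬_; Dec; does; yes; no)

∑ : {A : Set} → List A → (A → ℕ) → ℕ
∑ xs f = sumN (map f xs)

∑-++ : {A : Set} (xs ys : List A) (f : A → ℕ) → ∑ (xs ++ ys) f ≡ ∑ xs f + ∑ ys f
∑-++ []       ys f = refl
∑-++ (x ∷ xs) ys f = trans (cong (λ s → f x + s) (∑-++ xs ys f)) (sym (+-assoc (f x) (∑ xs f) (∑ ys f)))

∑-map : {A B : Set} (xs : List A) (g : A → B) (f : B → ℕ) → ∑ (map g xs) f ≡ ∑ xs (f ∘ g)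
∑-map []       g f = refl
∑-map (x ∷ xs) g f = cong (λ s → f (g x) + s) (∑-map xs g f)

∑-cong : {A : Set} (xs : List A) {f g : A → ℕ} → (∀ x → x ∈ xs → f x ≡ g x) → ∑ xs f ≡ ∑ xs g
∑-cong []       f≗g = refl
∑-cong (x ∷ xs) f≗g = cong₂ _+_ (f≗g x (here refl)) (∑-cong xs (λ y y∈ → f≗g y (there y∈)))

∑-+ : {A : Set} (xs : List A) (f g : A → ℕ) → ∑ xs f + ∑ xs g ≡ ∑ xs (λ x → f x + g x)
∑-+ []       f g = refl
∑-+ (x ∷ xs) f g = trans (shuffle (f x) (∑ xs f) (g x) (∑ xs g)) (cong (λ s → f x + g x + s) (∑-+ xs f g))
  where
  shuffle : ∀ a b c d → a + b + (c + d) ≡ a + c + (b + d)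
  shuffle = solve-∀

∑-*ˡ : {A : Set} (xs : List A) (k : ℕ) (f : A → ℕ) → ∑ xs (λ x → k * f x) ≡ k * ∑ xs f
∑-*ˡ []       k f = sym (*-zeroʳ k)
∑-*ˡ (x ∷ xs) k f = trans (cong (λ s → k * f x + s) (∑-*ˡ xs k f)) (sym (*-distribˡ-+ k (f x) (∑ xs f)))

∑-swap : {A B : Set} (xs : List A) (ys : List B) (h : A → B → ℕ) →
  ∑ xs (λ x → ∑ ys (h x)) ≡ ∑ ys (λ y → ∑ xs (λ x → h x y))
∑-swap []       ys h = sym (∑-zero ys)
  where
  ∑-zero : {B : Set} (ys : List B) → ∑ ys (λ _ → 0) ≡ 0
  ∑-zero []       = refl
  ∑-zero (y ∷ ys) = ∑-zero ys
∑-swap (x ∷ xs) ys h = trans (cong (λ s → ∑ ys (h x) + s) (∑-swap xs ys h)) (∑-+ ys (h x) _)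

∑-filter : {A : Set} {P : A → Set} (P? : ∀ x → Dec (P x)) (xs : List A) (f : A → ℕ) →
  ∑ (filter P? xs) f ≡ ∑ xs (λ x → if does (P? x) then f x else 0)
∑-filter P? []       f = refl
∑-filter P? (x ∷ xs) f with does (P? x)
... | true  = cong (λ s → f x + s) (∑-filter P? xs f)
... | false = ∑-filter P? xs f

∑-concatMap : {A B : Set} (g : A → List B) (xs : List A) (f : B → ℕ) →
  ∑ (concatMap g xs) f ≡ ∑ xs (λ x → ∑ (g x) f)
∑-concatMap g []       f = refl
∑-concatMap g (x ∷ xs) f = trans (∑-++ (g x) (concatMap g xs) f) (cong (λ s → ∑ (g x) f + s) (∑-concatMap g xs f))

∑-cartesianProduct : {A B : Set} (xs : List A) (ys : List B) (f : A × B → ℕ) →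
  ∑ (cartesianProduct xs ys) f ≡ ∑ xs (λ x → ∑ ys (λ y → f (x , y)))
∑-cartesianProduct []       ys f = refl
∑-cartesianProduct (x ∷ xs) ys f =
  trans (∑-++ (map (x ,_) ys) _ f) (cong₂ _+_ (∑-map ys (x ,_) f) (∑-cartesianProduct xs ys f))

∑-if : {A : Set} (xs : List A) (b : Bool) (f : A → ℕ) → (if b then ∑ xs f else 0) ≡ ∑ xs (λ x → if b then f x else 0)
∑-if xs       true  f = refl
∑-if []       false f = refl
∑-if (x ∷ xs) false f = ∑-if xs false f

length≡∑1 : {A : Set} (xs : List A) → length xs ≡ ∑ xs (λ _ → 1)
length≡∑1 []       = refl
length≡∑1 (x ∷ xs) = cong suc (length≡∑1 xs)

toℕ : Bool → ℕ
toℕ true  = 1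
toℕ false = 0

if≡toℕ : ∀ b → (if b then 1 else 0) ≡ toℕ b
if≡toℕ true  = refl
if≡toℕ false = refl

if≡toℕ* : ∀ b (v : ℕ) → (if b then v else 0) ≡ toℕ b * v
if≡toℕ* true  v = sym (+-identityʳ v)
if≡toℕ* false v = refl

toℕ-∧ : ∀ b c → toℕ (b ∧ c) ≡ (if b then toℕ c else 0)
toℕ-∧ true  c = refl
toℕ-∧ false c = refl

toℕ-+-not : ∀ b → toℕ b + toℕ (not b) ≡ 1
toℕ-+-not true  = refl
toℕ-+-not false = refl

does-≟-true : ∀ b → does (Data.Bool._≟_ b true) ≡ b
does-≟-true true  = refl
does-≟-true false = refl

countB≡∑ : {A : Set} (p : A → Bool) (xs : List A) → countB p xs ≡ ∑ xs (λ x → toℕ (p x))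
countB≡∑ p xs = trans (length≡∑1 (filter p? xs)) (trans (∑-filter p? xs (λ _ → 1))
  (∑-cong xs (λ x _ → trans (cong (λ b → if b then 1 else 0) (does-≟-true (p x))) (if≡toℕ (p x)))))
  where
  p? = λ a → Data.Bool._≟_ (p a) true

oneTo-suc : ∀ m → oneTo (suc m) ≡ 1 ∷ map suc (oneTo m)
oneTo-suc m = cong (λ l → 1 ∷ map suc l) (sym (map-upTo suc m))

oneTo-∷ʳ : ∀ m → oneTo (suc m) ≡ oneTo m ++ [ suc m ]
oneTo-∷ʳ m = trans (cong (map suc) (sym (upTo-∷ʳ m))) (map-++ suc (upTo m) [ m ])

∑-oneTo-suc : ∀ m (f : ℕ → ℕ) → ∑ (oneTo (suc m)) f ≡ f 1 + ∑ (oneTo m) (f ∘ suc)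
∑-oneTo-suc m f = trans (cong (λ l → ∑ l f) (oneTo-suc m)) (cong (λ s → f 1 + s) (∑-map (oneTo m) suc f))

∑-oneTo-∷ʳ : ∀ m (f : ℕ → ℕ) → ∑ (oneTo (suc m)) f ≡ ∑ (oneTo m) f + f (suc m)
∑-oneTo-∷ʳ m f = begin
  ∑ (oneTo (suc m)) f                ≡⟨ cong (λ l → ∑ l f) (oneTo-∷ʳ m) ⟩
  ∑ (oneTo m ++ [ suc m ]) f         ≡⟨ ∑-++ (oneTo m) [ suc m ] f ⟩
  ∑ (oneTo m) f + (f (suc m) + 0)    ≡⟨ cong (λ s → ∑ (oneTo m) f + s) (+-identityʳ (f (suc m))) ⟩
  ∑ (oneTo m) f + f (suc m)          ∎
  where open ≡-Reasoning

∑-oneTo-cong : ∀ m {f g : ℕ → ℕ} → (∀ i → 1 ≤ i → i ≤ m → f i ≡ g i) → ∑ (oneTo m) f ≡ ∑ (oneTo m) g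
∑-oneTo-cong zero    f≗g = refl
∑-oneTo-cong (suc m) {f} {g} f≗g =
  trans (∑-oneTo-suc m f) (trans (cong₂ _+_ (f≗g 1 (s≤s z≤n) (s≤s z≤n)) (∑-oneTo-cong m (λ i _ i≤m → f≗g (suc i) (s≤s z≤n) (s≤s i≤m))))
    (sym (∑-oneTo-suc m g)))

∑-oneTo-reflect : ∀ m (f : ℕ → ℕ) → ∑ (oneTo m) f ≡ ∑ (oneTo m) (λ i → f (suc m ∸ i))
∑-oneTo-reflect zero    f = refl
∑-oneTo-reflect (suc m) f = begin
  ∑ (oneTo (suc m)) f                                   ≡⟨ ∑-oneTo-∷ʳ m f ⟩
  ∑ (oneTo m) f + f (suc m)                             ≡⟨ cong (_+ f (suc m)) (∑-oneTo-reflect m f) ⟩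
  ∑ (oneTo m) (λ i → f (suc m ∸ i)) + f (suc m)         ≡⟨ +-comm _ (f (suc m)) ⟩
  f (suc m) + ∑ (oneTo m) (λ i → f (suc m ∸ i))         ≡⟨ sym (∑-oneTo-suc m (λ i → f (suc (suc m) ∸ i))) ⟩
  ∑ (oneTo (suc m)) (λ i → f (suc (suc m) ∸ i))         ∎
  where open ≡-Reasoning

length-oneTo : ∀ n → length (oneTo n) ≡ n
length-oneTo n = trans (length-map suc (upTo n)) (length-upTo n)

∑-oneTo-1 : ∀ m → ∑ (oneTo m) (λ _ → 1) ≡ m
∑-oneTo-1 m = trans (sym (length≡∑1 (oneTo m))) (length-oneTo m)

∑-oneTo-complementary : ∀ m (f g : ℕ → ℕ) → (∀ i → 1 ≤ i → i ≤ m → f i + g i ≡ 1) → ∑ (oneTo m) f + ∑ (oneTo m) g ≡ m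
∑-oneTo-complementary m f g f+g≡1 = trans (∑-+ (oneTo m) f g) (trans (∑-oneTo-cong m f+g≡1) (∑-oneTo-1 m))

T⇒≡true : ∀ {b} → T b → b ≡ true
T⇒≡true {true} _ = refl

¬T⇒≡false : ∀ {b} → ¬ T b → b ≡ false
¬T⇒≡false {true}  ¬b = ⊥-elim (¬b tt)
¬T⇒≡false {false} _  = refl

<ᵇ-true : ∀ {m n} → m < n → (m <ᵇ n) ≡ true
<ᵇ-true m<n = T⇒≡true (<⇒<ᵇ m<n)

<ᵇ-false : ∀ {m n} → n ≤ m → (m <ᵇ n) ≡ false
<ᵇ-false {m} {n} n≤m = ¬T⇒≡false (λ t → <⇒≱ (<ᵇ⇒< m n t) n≤m)

≡ᵇ-false : ∀ {a b} → a ≢ b → (a ≡ᵇ b) ≡ false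
≡ᵇ-false {a} {b} a≢b = ¬T⇒≡false (λ t → a≢b (≡ᵇ⇒≡ a b t))

≡ᵇ-refl : ∀ a → (a ≡ᵇ a) ≡ true
≡ᵇ-refl a = T⇒≡true (≡⇒≡ᵇ a a refl)

T-ext : ∀ {b c : Bool} → (T b → T c) → (T c → T b) → b ≡ c
T-ext {true}  {true}  _ _ = refl
T-ext {true}  {false} f _ = ⊥-elim (f tt)
T-ext {false} {true}  _ g = ⊥-elim (g tt)
T-ext {false} {false} _ _ = refl

<ᵇ-swap : ∀ {m n} → m ≢ n → (n <ᵇ m) ≡ not (m <ᵇ n)
<ᵇ-swap {m} {n} m≢n with <-cmp m n
... | tri< m<n _ _ rewrite <ᵇ-true m<n = <ᵇ-false (<⇒≤ m<n)
... | tri≈ _ m≡n _ = ⊥-elim (m≢n m≡n)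
... | tri> _ _ n<m rewrite <ᵇ-true n<m | <ᵇ-false (<⇒≤ n<m) = refl

<ᵇ-+-swap : ∀ {m n} → m ≢ n → toℕ (m <ᵇ n) + toℕ (n <ᵇ m) ≡ 1
<ᵇ-+-swap {m} {n} m≢n rewrite <ᵇ-swap m≢n = toℕ-+-not (m <ᵇ n)

∸-<ᵇ-∸ : ∀ N {m n} → m ≤ N → n ≤ N → (N ∸ m <ᵇ N ∸ n) ≡ (n <ᵇ m)
∸-<ᵇ-∸ N {m} {n} m≤N n≤N = T-ext
  (λ t → <⇒<ᵇ (∸-cancelʳ-< {m} {n} {N} (<ᵇ⇒< (N ∸ m) (N ∸ n) t)))
  (λ t → <⇒<ᵇ (∸-monoʳ-< (<ᵇ⇒< n m t) m≤N))

-- Homomesy of involutions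

a/1≡[a+a]/2 : ∀ a → (a ℤ.+ + 0) ℚ./ 1 ≡ (a ℤ.+ a) ℚ./ 2
a/1≡[a+a]/2 a = ℚP.fromℚᵘ-cong {mkℚᵘ (a ℤ.+ + 0) 0} {mkℚᵘ (a ℤ.+ a) 1} (*≡* (cross a))
  where
  cross : ∀ a → (a ℤ.+ + 0) ℤ.* + 2 ≡ (a ℤ.+ a) ℤ.* + 1
  cross = ℤ-Solver.solve-∀

homomesic-involution : {A : Set} (S : A → Set) (X : A → A) (f : A → ℤ) (K : ℤ) →
  (∀ x → S x → X (X x) ≡ x) → (∀ x → S x → f x ℤ.+ f (X x) ≡ K) → Homomesic S X f
homomesic-involution S X f K X²≡id pairSum = K ℚ./ 2 , average
  where
  average : ∀ x → S x → ∀ m → OrbitSize X x (suc m) → orbitSum X f x (suc m) ℚ./ suc m ≡ K ℚ./ 2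
  average x x∈S zero (_ , Xx≡x , _) = begin
    (f x ℤ.+ + 0) ℚ./ 1      ≡⟨ a/1≡[a+a]/2 (f x) ⟩
    (f x ℤ.+ f x) ℚ./ 2      ≡⟨ cong (λ y → (f x ℤ.+ f y) ℚ./ 2) (sym Xx≡x) ⟩
    (f x ℤ.+ f (X x)) ℚ./ 2  ≡⟨ cong (ℚ._/ 2) (pairSum x x∈S) ⟩
    K ℚ./ 2                  ∎
    where open ≡-Reasoning
  average x x∈S (suc zero) _ =
    cong (ℚ._/ 2) (trans (cong (λ y → f x ℤ.+ y) (ℤP.+-identityʳ (f (X x)))) (pairSum x x∈S))
  average x x∈S (suc (suc m)) (_ , _ , minimal) =
    ⊥-elim (minimal 2 (s≤s z≤n) (s≤s (s≤s (s≤s z≤n))) (X²≡id x x∈S))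

Unique-resp-↭ : ∀ {xs ys : List ℕ} → xs ↭ ys → Unique xs → Unique ys
Unique-resp-↭ ↭.refl          u                           = u
Unique-resp-↭ (↭.prep x p)    (x∉ ∷ u)                    = All-resp-↭ p x∉ ∷ Unique-resp-↭ p u
Unique-resp-↭ (↭.swap x y p)  ((x≢y ∷ x∉) ∷ y∉ ∷ u)       =
  ((λ y≡x → x≢y (sym y≡x)) ∷ All-resp-↭ p y∉) ∷ All-resp-↭ p x∉ ∷ Unique-resp-↭ p u
Unique-resp-↭ (↭.trans p q)   u                           = Unique-resp-↭ q (Unique-resp-↭ p u)

∈-oneTo⁻ : ∀ {x} n → x ∈ oneTo n → 1 ≤ x × x ≤ n
∈-oneTo⁻ n x∈ with ∈-map⁻ suc x∈
... | y , y∈ , refl = s≤s z≤n , ∈-upTo⁻ y∈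

at-cons : ∀ x xs j → 1 ≤ j → at (x ∷ xs) (suc j) ≡ at xs j
at-cons x xs (suc j) _ = refl

at-∈ : ∀ σ i → 1 ≤ i → i ≤ length σ → at σ i ∈ σ
at-∈ (x ∷ xs) (suc zero)    _ _         = here refl
at-∈ (x ∷ xs) (suc (suc k)) _ (s≤s le) = there (at-∈ xs (suc k) (s≤s z≤n) le)

at-injective : ∀ σ → Unique σ → ∀ i j → 1 ≤ i → i ≤ length σ → 1 ≤ j → j ≤ length σ → at σ i ≡ at σ j → i ≡ j
at-injective (x ∷ xs) u          (suc zero)    (suc zero)    _ _        _ _         _ = refl
at-injective (x ∷ xs) (x∉ ∷ u)   (suc zero)    (suc (suc k)) _ _        _ (s≤s le) e =
  ⊥-elim (All.lookup x∉ (at-∈ xs (suc k) (s≤s z≤n) le) e)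
at-injective (x ∷ xs) (x∉ ∷ u)   (suc (suc k)) (suc zero)    _ (s≤s le) _ _        e =
  ⊥-elim (All.lookup x∉ (at-∈ xs (suc k) (s≤s z≤n) le) (sym e))
at-injective (x ∷ xs) (x∉ ∷ u)   (suc (suc k)) (suc (suc l)) _ (s≤s le) _ (s≤s le') e =
  cong suc (at-injective xs u (suc k) (suc l) (s≤s z≤n) le (s≤s z≤n) le' e)

at-++ : ∀ ys zs i → 1 ≤ i → i ≤ length ys → at (ys ++ zs) i ≡ at ys i
at-++ (y ∷ ys) zs (suc zero)    _ _        = refl
at-++ (y ∷ ys) zs (suc (suc k)) _ (s≤s le) = at-++ ys zs (suc k) (s≤s z≤n) le

at-∷ʳ : ∀ ys x → at (ys ++ [ x ]) (suc (length ys)) ≡ x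
at-∷ʳ []       x = refl
at-∷ʳ (y ∷ ys) x = at-∷ʳ ys x

at-reverse : ∀ σ i → 1 ≤ i → i ≤ length σ → at (reverse σ) i ≡ at σ (suc (length σ) ∸ i)
at-reverse []       (suc i) _ ()
at-reverse (x ∷ xs) i 1≤i i≤ rewrite unfold-reverse x xs with m≤n⇒m<n∨m≡n i≤
... | inj₂ refl = begin
  at (reverse xs ++ [ x ]) (suc (length xs))            ≡⟨ cong (λ l → at (reverse xs ++ [ x ]) (suc l)) (sym (length-reverse xs)) ⟩
  at (reverse xs ++ [ x ]) (suc (length (reverse xs)))  ≡⟨ at-∷ʳ (reverse xs) x ⟩
  x                                                     ≡⟨ cong (at (x ∷ xs)) (sym (m+n∸n≡m 1 (length xs))) ⟩
  at (x ∷ xs) (suc (suc (length xs)) ∸ suc (length xs)) ∎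
  where open ≡-Reasoning
... | inj₁ (s≤s i≤xs) = begin
  at (reverse xs ++ [ x ]) i                  ≡⟨ at-++ (reverse xs) [ x ] i 1≤i (subst (i ≤_) (sym (length-reverse xs)) i≤xs) ⟩
  at (reverse xs) i                           ≡⟨ at-reverse xs i 1≤i i≤xs ⟩
  at xs (suc (length xs) ∸ i)                 ≡⟨ sym (at-cons x xs (suc (length xs) ∸ i) (m<n⇒0<n∸m (s≤s i≤xs))) ⟩
  at (x ∷ xs) (suc (suc (length xs) ∸ i))     ≡⟨ cong (at (x ∷ xs)) (sym (+-∸-assoc 1 (m≤n⇒m≤1+n i≤xs))) ⟩
  at (x ∷ xs) (suc (suc (length xs)) ∸ i)     ∎
  where open ≡-Reasoning

at-map : ∀ (g : ℕ → ℕ) σ i → 1 ≤ i → i ≤ length σ → at (map g σ) i ≡ g (at σ i)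
at-map g (x ∷ xs) (suc zero)    _ _        = refl
at-map g (x ∷ xs) (suc (suc k)) _ (s≤s le) = at-map g xs (suc k) (s≤s z≤n) le

∑-at : ∀ σ (g : ℕ → ℕ) → ∑ (oneTo (length σ)) (λ i → g (at σ i)) ≡ ∑ σ g
∑-at []       g = refl
∑-at (x ∷ xs) g = trans (∑-oneTo-suc (length xs) (λ i → g (at (x ∷ xs) i)))
  (cong (λ s → g x + s) (trans (∑-oneTo-cong (length xs) (λ i 1≤i _ → cong g (at-cons x xs i 1≤i))) (∑-at xs g)))

InjectiveOn : ℕ → (ℕ → ℕ) → Set
InjectiveOn n a = ∀ i j → 1 ≤ i → i ≤ n → 1 ≤ j → j ≤ n → i ≢ j → a i ≢ a j

record Arrangement (n : ℕ) (σ : List ℕ) : Set where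
  field
    length≡   : length σ ≡ n
    at≤n      : ∀ i → 1 ≤ i → i ≤ n → at σ i ≤ n
    at-inj    : InjectiveOn n (at σ)
    ∑-values  : ∀ (g : ℕ → ℕ) → ∑ (oneTo n) (λ i → g (at σ i)) ≡ ∑ (oneTo n) g
    ∈-range   : ∀ x → x ∈ σ → 1 ≤ x × x ≤ n
    unique    : Unique σ

  at≤1+n : ∀ i → 1 ≤ i → i ≤ n → at σ i ≤ suc n
  at≤1+n i 1≤i i≤n = m≤n⇒m≤1+n (at≤n i 1≤i i≤n)

arrangement : ∀ {n σ} → Perm n σ → Arrangement n σ
arrangement {n} {σ} p = record
  { length≡  = len
  ; at≤n     = λ i 1≤i i≤n → proj₂ (∈-oneTo⁻ n (∈-resp-↭ p (at-∈ σ i 1≤i (≤len i≤n))))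
  ; at-inj   = λ i j 1≤i i≤n 1≤j j≤n i≢j e → i≢j (at-injective σ uniq i j 1≤i (≤len i≤n) 1≤j (≤len j≤n) e)
  ; ∑-values = λ g → begin
      ∑ (oneTo n) (λ i → g (at σ i))  ≡⟨ cong (λ m → ∑ (oneTo m) (λ i → g (at σ i))) (sym len) ⟩
      ∑ (oneTo (length σ)) (λ i → g (at σ i)) ≡⟨ ∑-at σ g ⟩
      ∑ σ g                           ≡⟨ sum-↭ (map⁺ g p) ⟩
      ∑ (oneTo n) g                   ∎
  ; ∈-range  = λ x x∈ → ∈-oneTo⁻ n (∈-resp-↭ p x∈)
  ; unique   = uniq
  }
  where
  open ≡-Reasoning
  len : length σ ≡ n
  len = trans (↭-length p) (length-oneTo n)
  ≤len : ∀ {i} → i ≤ n → i ≤ length σ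
  ≤len = subst (_ ≤_) (sym len)
  uniq : Unique σ
  uniq = Unique-resp-↭ (↭-sym p) (Unique.map⁺ suc-injective (Unique.upTo⁺ n))

compMap-oneTo : ∀ m → compMap m (oneTo m) ≡ reverse (oneTo m)
compMap-oneTo zero    = refl
compMap-oneTo (suc m) = begin
  compMap (suc m) (oneTo (suc m))                   ≡⟨ cong (compMap (suc m)) (oneTo-suc m) ⟩
  suc m ∷ compMap (suc m) (map suc (oneTo m))       ≡⟨ cong (suc m ∷_) (sym (map-∘ (oneTo m))) ⟩
  suc m ∷ compMap m (oneTo m)                       ≡⟨ cong (suc m ∷_) (compMap-oneTo m) ⟩
  suc m ∷ reverse (oneTo m)                         ≡⟨ sym (reverse-++ (oneTo m) [ suc m ]) ⟩
  reverse (oneTo m ++ [ suc m ])                    ≡⟨ cong reverse (sym (oneTo-∷ʳ m)) ⟩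
  reverse (oneTo (suc m))                           ∎
  where open ≡-Reasoning

revMap-Perm : ∀ {n σ} → Perm n σ → Perm n (revMap σ)
revMap-Perm {σ = σ} p = ↭-trans (↭-reverse σ) p

compMap-Perm : ∀ {n σ} → Perm n σ → Perm n (compMap n σ)
compMap-Perm {n} p = ↭-trans (map⁺ (λ v → suc n ∸ v) p) (↭-trans (↭-reflexive (compMap-oneTo n)) (↭-reverse (oneTo n)))

compMap-involutive : ∀ n σ → (∀ x → x ∈ σ → x ≤ n) → compMap n (compMap n σ) ≡ σ
compMap-involutive n []       _   = refl
compMap-involutive n (x ∷ xs) ≤n  =
  cong₂ _∷_ (m∸[m∸n]≡n (m≤n⇒m≤1+n (≤n x (here refl)))) (compMap-involutive n xs (λ y y∈ → ≤n y (there y∈)))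

module _ {n σ} (g : Arrangement n σ) where
  open Arrangement g

  length-revMap : length (revMap σ) ≡ n
  length-revMap = trans (length-reverse σ) length≡

  length-compMap : length (compMap n σ) ≡ n
  length-compMap = trans (length-map _ σ) length≡

  at-revMap : ∀ i → 1 ≤ i → i ≤ n → at (revMap σ) i ≡ at σ (suc n ∸ i)
  at-revMap i 1≤i i≤n = trans (at-reverse σ i 1≤i (subst (i ≤_) (sym length≡) i≤n)) (cong (λ m → at σ (suc m ∸ i)) length≡)

  at-compMap : ∀ i → 1 ≤ i → i ≤ n → at (compMap n σ) i ≡ suc n ∸ at σ i
  at-compMap i 1≤i i≤n = at-map (λ v → suc n ∸ v) σ i 1≤i (subst (i ≤_) (sym length≡) i≤n)

record PairSumConstant (X : List ℕ → List ℕ) (n : ℕ) (f : List ℕ → ℤ) : Set where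
  constructor pairSumIs
  field
    total   : ℤ
    pairSum : ∀ σ → Perm n σ → f σ ℤ.+ f (X σ) ≡ total

Balanced : ℕ → (List ℕ → ℤ) → Set
Balanced n f = PairSumConstant revMap n f × PairSumConstant (compMap n) n f

Balanced⇒homomesic : ∀ n {f} → Balanced n f → Homomesic (Perm n) revMap f × Homomesic (Perm n) (compMap n) f
Balanced⇒homomesic n {f} (pairSumIs KR R , pairSumIs KC C) =
  homomesic-involution (Perm n) revMap f KR (λ σ _ → reverse-involutive σ) R ,
  homomesic-involution (Perm n) (compMap n) f KC
    (λ σ p → compMap-involutive n σ (λ x x∈ → proj₂ (Arrangement.∈-range (arrangement p) x x∈))) C

module _ {X : List ℕ → List ℕ} {n : ℕ} where

  pairSumℕ : ∀ {g : List ℕ → ℕ} {K} → (∀ σ → Perm n σ → g σ + g (X σ) ≡ K) → PairSumConstant X n (λ σ → + g σ)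
  pairSumℕ {K = K} g+gX≡K = pairSumIs (+ K) λ σ p → cong +_ (g+gX≡K σ p)

  pairSum-+ : ∀ {f g} → PairSumConstant X n f → PairSumConstant X n g → PairSumConstant X n (λ σ → f σ ℤ.+ g σ)
  pairSum-+ {f} {g} (pairSumIs K f+fX≡K) (pairSumIs L g+gX≡L) = pairSumIs (K ℤ.+ L) λ σ p →
    trans (shuffle (f σ) (g σ) (f (X σ)) (g (X σ))) (cong₂ ℤ._+_ (f+fX≡K σ p) (g+gX≡L σ p))
    where
    shuffle : ∀ a b c d → (a ℤ.+ b) ℤ.+ (c ℤ.+ d) ≡ (a ℤ.+ c) ℤ.+ (b ℤ.+ d)
    shuffle = ℤ-Solver.solve-∀

  pairSum-affine : ∀ a b {f} → PairSumConstant X n f → PairSumConstant X n (λ σ → a ℤ.+ b ℤ.* f σ)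
  pairSum-affine a b {f} (pairSumIs K f+fX≡K) = pairSumIs ((a ℤ.+ a) ℤ.+ b ℤ.* K) λ σ p →
    trans (regroup a b (f σ) (f (X σ))) (cong (λ s → (a ℤ.+ a) ℤ.+ b ℤ.* s) (f+fX≡K σ p))
    where
    regroup : ∀ a b x y → (a ℤ.+ b ℤ.* x) ℤ.+ (a ℤ.+ b ℤ.* y) ≡ (a ℤ.+ a) ℤ.+ b ℤ.* (x ℤ.+ y)
    regroup = ℤ-Solver.solve-∀

  pairSum-resp : ∀ {f g} → (∀ {σ} → Perm n σ → Perm n (X σ)) → (∀ σ → Perm n σ → f σ ≡ g σ) →
    PairSumConstant X n f → PairSumConstant X n g
  pairSum-resp X-Perm f≡g (pairSumIs K f+fX≡K) = pairSumIs K λ σ p → trans (sym (cong₂ ℤ._+_ (f≡g σ p) (f≡g _ (X-Perm p)))) (f+fX≡K σ p)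

Balanced-+ : ∀ {n f g} → Balanced n f → Balanced n g → Balanced n (λ σ → f σ ℤ.+ g σ)
Balanced-+ (fR , fC) (gR , gC) = pairSum-+ fR gR , pairSum-+ fC gC

Balanced-affine : ∀ {n} a b {f} → Balanced n f → Balanced n (λ σ → a ℤ.+ b ℤ.* f σ)
Balanced-affine a b (fR , fC) = pairSum-affine a b fR , pairSum-affine a b fC

Balanced-resp : ∀ {n f g} → (∀ σ → Perm n σ → f σ ≡ g σ) → Balanced n f → Balanced n g
Balanced-resp f≡g (fR , fC) = pairSum-resp revMap-Perm f≡g fR , pairSum-resp compMap-Perm f≡g fC

-- Statistics counting pairs of positions: (1)–(9)

PosPair : ℕ → ℕ × ℕ → Set
PosPair n (i , j) = 1 ≤ i × i < j × j ≤ n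

∈-posPairs⁻ : ∀ n p → p ∈ posPairs n → PosPair n p
∈-posPairs⁻ n p p∈ with ∈-filter⁻ (λ p → proj₁ p ℕ.<? proj₂ p) {xs = cartesianProduct (oneTo n) (oneTo n)} p∈
... | p∈prod , i<j with ∈-cartesianProduct⁻ (oneTo n) (oneTo n) p∈prod
... | i∈ , j∈ = proj₁ (∈-oneTo⁻ n i∈) , i<j , proj₂ (∈-oneTo⁻ n j∈)

∑-posPairs : ∀ n (h : ℕ × ℕ → ℕ) → ∑ (posPairs n) h ≡ ∑ (oneTo n) (λ i → ∑ (oneTo n) (λ j → if i <ᵇ j then h (i , j) else 0))
∑-posPairs n h = trans (∑-filter (λ p → proj₁ p ℕ.<? proj₂ p) (cartesianProduct (oneTo n) (oneTo n)) h)
  (∑-cartesianProduct (oneTo n) (oneTo n) _)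

∑-posPairs-cong : ∀ n {f g : ℕ × ℕ → ℕ} → (∀ p → PosPair n p → f p ≡ g p) → ∑ (posPairs n) f ≡ ∑ (posPairs n) g
∑-posPairs-cong n f≗g = ∑-cong (posPairs n) (λ p p∈ → f≗g p (∈-posPairs⁻ n p p∈))

reflectPair : ℕ → ℕ × ℕ → ℕ × ℕ
reflectPair n p = suc n ∸ proj₂ p , suc n ∸ proj₁ p

∑-posPairs-reflect : ∀ n (h : ℕ × ℕ → ℕ) → ∑ (posPairs n) h ≡ ∑ (posPairs n) (h ∘ reflectPair n)
∑-posPairs-reflect n h = begin
  ∑ (posPairs n) h
    ≡⟨ ∑-posPairs n h ⟩
  ∑ O (λ i → ∑ O (λ j → if i <ᵇ j then h (i , j) else 0))
    ≡⟨ ∑-oneTo-reflect n _ ⟩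
  ∑ O (λ i → ∑ O (λ j → if N ∸ i <ᵇ j then h (N ∸ i , j) else 0))
    ≡⟨ ∑-oneTo-cong n (λ i _ _ → ∑-oneTo-reflect n _) ⟩
  ∑ O (λ i → ∑ O (λ j → if N ∸ i <ᵇ N ∸ j then h (N ∸ i , N ∸ j) else 0))
    ≡⟨ ∑-oneTo-cong n (λ i _ i≤n → ∑-oneTo-cong n (λ j _ j≤n →
         cong (λ b → if b then h (N ∸ i , N ∸ j) else 0) (∸-<ᵇ-∸ N (m≤n⇒m≤1+n i≤n) (m≤n⇒m≤1+n j≤n)))) ⟩
  ∑ O (λ i → ∑ O (λ j → if j <ᵇ i then h (N ∸ i , N ∸ j) else 0))
    ≡⟨ ∑-swap O O _ ⟩
  ∑ O (λ j → ∑ O (λ i → if j <ᵇ i then h (N ∸ i , N ∸ j) else 0))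
    ≡⟨ sym (∑-posPairs n (h ∘ reflectPair n)) ⟩
  ∑ (posPairs n) (h ∘ reflectPair n) ∎
  where
  open ≡-Reasoning
  O = oneTo n
  N = suc n

-- P (i , j) σᵢ σⱼ decides whether the pair of positions i < j is counted.
PairPredicate : Set
PairPredicate = ℕ × ℕ → ℕ → ℕ → Bool

swapValues : PairPredicate → PairPredicate
swapValues P p x y = P p y x

pairStat : ℕ → (ℕ → ℕ) → PairPredicate → (ℕ × ℕ → ℕ) → ℕ
pairStat n a P w = ∑ (posPairs n) (λ p → if P p (a (proj₁ p)) (a (proj₂ p)) then w p else 0)

module _ (n : ℕ) (P : PairPredicate) (w : ℕ × ℕ → ℕ) where

  pairStat-cong : ∀ {a b} → (∀ i → 1 ≤ i → i ≤ n → a i ≡ b i) → pairStat n a P w ≡ pairStat n b P w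
  pairStat-cong a≗b = ∑-posPairs-cong n (λ { (i , j) (1≤i , i<j , j≤n) →
    cong₂ (λ x y → if P (i , j) x y then w (i , j) else 0)
      (a≗b i 1≤i (≤-trans (<⇒≤ i<j) j≤n)) (a≗b j (≤-trans 1≤i (<⇒≤ i<j)) j≤n) })

  pairStat-+-swapValues : ∀ a →
    (∀ p → PosPair n p → ∀ x y → x ≢ y → toℕ (P p x y) + toℕ (P p y x) ≡ 1) → InjectiveOn n a →
    pairStat n a P w + pairStat n a (swapValues P) w ≡ ∑ (posPairs n) w
  pairStat-+-swapValues a exactlyOne a-inj = trans (∑-+ (posPairs n) _ _) (∑-posPairs-cong n (λ { (i , j) ij@(1≤i , i<j , j≤n) →
    let b  = P (i , j) (a i) (a j)
        b′ = P (i , j) (a j) (a i)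
        a≢ = a-inj i j 1≤i (≤-trans (<⇒≤ i<j) j≤n) (≤-trans 1≤i (<⇒≤ i<j)) j≤n (λ i≡j → <-irrefl i≡j i<j)
    in begin
      (if b then w (i , j) else 0) + (if b′ then w (i , j) else 0)  ≡⟨ cong₂ _+_ (if≡toℕ* b (w (i , j))) (if≡toℕ* b′ (w (i , j))) ⟩
      toℕ b * w (i , j) + toℕ b′ * w (i , j)                       ≡⟨ sym (*-distribʳ-+ (w (i , j)) (toℕ b) (toℕ b′)) ⟩
      (toℕ b + toℕ b′) * w (i , j)                                 ≡⟨ cong (_* w (i , j)) (exactlyOne (i , j) ij (a i) (a j) a≢) ⟩
      1 * w (i , j)                                                ≡⟨ *-identityˡ (w (i , j)) ⟩
      w (i , j)                                                    ∎ }))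
    where open ≡-Reasoning

  pairStat-complement : ∀ a → (∀ i → 1 ≤ i → i ≤ n → a i ≤ suc n) →
    (∀ p x y → x ≤ suc n → y ≤ suc n → P p (suc n ∸ x) (suc n ∸ y) ≡ P p y x) →
    pairStat n (λ i → suc n ∸ a i) P w ≡ pairStat n a (swapValues P) w
  pairStat-complement a a≤ complementSwaps = ∑-posPairs-cong n (λ { (i , j) (1≤i , i<j , j≤n) →
    cong (λ b → if b then w (i , j) else 0) (complementSwaps (i , j) (a i) (a j)
      (a≤ i 1≤i (≤-trans (<⇒≤ i<j) j≤n)) (a≤ j (≤-trans 1≤i (<⇒≤ i<j)) j≤n)) })

  pairStat-reflect : ∀ a → (∀ p → PosPair n p → w (reflectPair n p) ≡ w p) →
    (∀ p → PosPair n p → ∀ x y → P (reflectPair n p) x y ≡ P p x y) →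
    pairStat n (λ i → a (suc n ∸ i)) P w ≡ pairStat n a (swapValues P) w
  pairStat-reflect a w-reflect P-reflect = trans
    (∑-posPairs-cong n (λ p pp →
      cong₂ (λ b v → if b then v else 0) (sym (P-reflect p pp _ _)) (sym (w-reflect p pp))))
    (sym (∑-posPairs-reflect n (λ p → if P p (a (proj₂ p)) (a (proj₁ p)) then w p else 0)))

  pairStat-balanced :
    (∀ p → PosPair n p → ∀ x y → x ≢ y → toℕ (P p x y) + toℕ (P p y x) ≡ 1) →
    (∀ p x y → x ≤ suc n → y ≤ suc n → P p (suc n ∸ x) (suc n ∸ y) ≡ P p y x) →
    (∀ p → PosPair n p → ∀ x y → P (reflectPair n p) x y ≡ P p x y) →
    (∀ p → PosPair n p → w (reflectPair n p) ≡ w p) →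
    Balanced n (λ σ → + pairStat (length σ) (at σ) P w)
  pairStat-balanced exactlyOne complementSwaps P-reflect w-reflect =
    pairSumℕ (λ σ p → let g = arrangement p in
      total {σ} {revMap σ} g (length-revMap g) (trans (pairStat-cong (at-revMap g))
        (pairStat-reflect (at σ) w-reflect P-reflect))) ,
    pairSumℕ (λ σ p → let g = arrangement p in
      total {σ} {compMap n σ} g (length-compMap g) (trans (pairStat-cong (at-compMap g))
        (pairStat-complement (at σ) (Arrangement.at≤1+n g) complementSwaps)))
    where
    total : ∀ {σ τ} → Arrangement n σ → length τ ≡ n → pairStat n (at τ) P w ≡ pairStat n (at σ) (swapValues P) w →
      pairStat (length σ) (at σ) P w + pairStat (length τ) (at τ) P w ≡ ∑ (posPairs n) w
    total {σ} g lenτ τ≡swap rewrite Arrangement.length≡ g | lenτ =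
      trans (cong (λ s → pairStat n (at σ) P w + s) τ≡swap) (pairStat-+-swapValues (at σ) exactlyOne (Arrangement.at-inj g))

countB≡pairStat : ∀ (P : PairPredicate) σ →
  countB (λ p → P p (at σ (proj₁ p)) (at σ (proj₂ p))) (posPairs (length σ)) ≡ pairStat (length σ) (at σ) P (λ _ → 1)
countB≡pairStat P σ = trans (countB≡∑ _ (posPairs (length σ))) (∑-cong (posPairs (length σ)) (λ p _ → sym (if≡toℕ _)))

countB-∧≡pairStat : ∀ (P : PairPredicate) (c : ℕ × ℕ → Bool) σ →
  countB (λ p → P p (at σ (proj₁ p)) (at σ (proj₂ p)) ∧ c p) (posPairs (length σ)) ≡ pairStat (length σ) (at σ) P (toℕ ∘ c)
countB-∧≡pairStat P c σ = trans (countB≡∑ _ (posPairs (length σ))) (∑-cong (posPairs (length σ)) (λ p _ → toℕ-∧ _ (c p)))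

∑dist≡pairStat : ∀ (P : PairPredicate) σ →
  sumN (map dist (filter (λ p → Data.Bool._≟_ (P p (at σ (proj₁ p)) (at σ (proj₂ p))) true) (posPairs (length σ))))
    ≡ pairStat (length σ) (at σ) P dist
∑dist≡pairStat P σ = trans (∑-filter _ (posPairs (length σ)) dist)
  (∑-cong (posPairs (length σ)) (λ p _ → cong (λ b → if b then dist p else 0) (does-≟-true _)))

∸-∸-∸ : ∀ N i j → i ≤ j → j ≤ N → (N ∸ i) ∸ (N ∸ j) ≡ j ∸ i
∸-∸-∸ N i j i≤j j≤N with m≤n⇒∃[o]m+o≡n j≤N
... | k , refl = begin
  (j + k ∸ i) ∸ (j + k ∸ j)  ≡⟨ cong₂ _∸_ (+-∸-comm k i≤j) (m+n∸m≡n j k) ⟩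
  (j ∸ i + k) ∸ k            ≡⟨ m+n∸n≡m (j ∸ i) k ⟩
  j ∸ i                      ∎
  where open ≡-Reasoning

dist-reflectPair : ∀ n p → PosPair n p → dist (reflectPair n p) ≡ dist p
dist-reflectPair n (i , j) (_ , i<j , j≤n) = ∸-∸-∸ (suc n) i j (<⇒≤ i<j) (m≤n⇒m≤1+n j≤n)

byValueOrder-balanced : ∀ n (lt : ℕ → ℕ → Bool) (W : ℕ → ℕ) →
  (∀ x y → x ≢ y → toℕ (lt x y) + toℕ (lt y x) ≡ 1) →
  (∀ x y → x ≤ suc n → y ≤ suc n → lt (suc n ∸ x) (suc n ∸ y) ≡ lt y x) →
  Balanced n (λ σ → + pairStat (length σ) (at σ) (λ _ → lt) (W ∘ dist))
byValueOrder-balanced n lt W exactlyOne complementSwaps = pairStat-balanced n (λ _ → lt) (W ∘ dist)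
  (λ _ _ → exactlyOne) (λ _ → complementSwaps) (λ _ _ _ _ → refl) (λ p pp → cong W (dist-reflectPair n p pp))

invertedᵖ orderedᵖ : PairPredicate
invertedᵖ _ x y = y <ᵇ x
orderedᵖ  _ x y = x <ᵇ y

inversionsBy-balanced : ∀ n (W : ℕ → ℕ) → Balanced n (λ σ → + pairStat (length σ) (at σ) invertedᵖ (W ∘ dist))
inversionsBy-balanced n W = byValueOrder-balanced n (λ x y → y <ᵇ x) W
  (λ x y x≢y → <ᵇ-+-swap (λ y≡x → x≢y (sym y≡x))) (λ x y x≤ y≤ → ∸-<ᵇ-∸ (suc n) y≤ x≤)

nonInversionsBy-balanced : ∀ n (W : ℕ → ℕ) → Balanced n (λ σ → + pairStat (length σ) (at σ) orderedᵖ (W ∘ dist))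
nonInversionsBy-balanced n W = byValueOrder-balanced n _<ᵇ_ W (λ x y → <ᵇ-+-swap) (λ x y → ∸-<ᵇ-∸ (suc n))

inversions-balanced : ∀ n → Balanced n inversions
inversions-balanced n = Balanced-resp (λ σ _ → cong +_ (sym (countB≡pairStat invertedᵖ σ))) (inversionsBy-balanced n (λ _ → 1))

inversionSum-balanced : ∀ n → Balanced n inversionSum
inversionSum-balanced n = Balanced-resp (λ σ _ → cong +_ (sym (∑dist≡pairStat invertedᵖ σ))) (inversionsBy-balanced n (λ d → d))

nonInversions-balanced : ∀ n → Balanced n nonInversions
nonInversions-balanced n = Balanced-resp (λ σ _ → cong +_ (sym (countB≡pairStat orderedᵖ σ))) (nonInversionsBy-balanced n (λ _ → 1))

nonInversionSum-balanced : ∀ n → Balanced n nonInversionSum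
nonInversionSum-balanced n = Balanced-resp (λ σ _ → cong +_ (sym (∑dist≡pairStat orderedᵖ σ))) (nonInversionsBy-balanced n (λ d → d))

inversionsWithDistance-balanced : ∀ n (c : ℕ → Bool) →
  Balanced n (λ σ → + countB (λ p → isInv σ p ∧ c (dist p)) (posPairs (length σ)))
inversionsWithDistance-balanced n c =
  Balanced-resp (λ σ _ → cong +_ (sym (countB-∧≡pairStat invertedᵖ (c ∘ dist) σ))) (inversionsBy-balanced n (toℕ ∘ c))

isEven-suc : ∀ m → isEven (suc m) ≡ not (isEven m)
isEven-suc zero          = refl
isEven-suc (suc zero)    = refl
isEven-suc (suc (suc m)) = isEven-suc m

not-⇔ᵇ : ∀ x y → not (x ⇔ᵇ y) ≡ (not x ⇔ᵇ y)
not-⇔ᵇ true  y     = refl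
not-⇔ᵇ false true  = refl
not-⇔ᵇ false false = refl

⇔ᵇ-not : ∀ x y → (x ⇔ᵇ not y) ≡ not (x ⇔ᵇ y)
⇔ᵇ-not true  y     = refl
⇔ᵇ-not false true  = refl
⇔ᵇ-not false false = refl

⇔ᵇ-true : ∀ x y → (x ⇔ᵇ y) ≡ true → x ≡ y
⇔ᵇ-true true  true  _ = refl
⇔ᵇ-true false false _ = refl

isEven-+ : ∀ a b → isEven (a + b) ≡ (isEven a ⇔ᵇ isEven b)
isEven-+ zero    b = refl
isEven-+ (suc a) b = begin
  isEven (suc a + b)              ≡⟨ isEven-suc (a + b) ⟩
  not (isEven (a + b))            ≡⟨ cong not (isEven-+ a b) ⟩
  not (isEven a ⇔ᵇ isEven b)      ≡⟨ not-⇔ᵇ (isEven a) (isEven b) ⟩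
  not (isEven a) ⇔ᵇ isEven b      ≡⟨ cong (_⇔ᵇ isEven b) (sym (isEven-suc a)) ⟩
  isEven (suc a) ⇔ᵇ isEven b      ∎
  where open ≡-Reasoning

-- (N ∸ j) + (N ∸ i) + (i + j) = 2N is even.
isEven-reflect : ∀ N i j → i ≤ N → j ≤ N → isEven ((N ∸ j) + (N ∸ i)) ≡ isEven (i + j)
isEven-reflect N i j i≤N j≤N = ⇔ᵇ-true _ _ (begin
  isEven ((N ∸ j) + (N ∸ i)) ⇔ᵇ isEven (i + j)  ≡⟨ sym (isEven-+ ((N ∸ j) + (N ∸ i)) (i + j)) ⟩
  isEven ((N ∸ j) + (N ∸ i) + (i + j))           ≡⟨ cong isEven (regroup (N ∸ j) (N ∸ i) i j) ⟩
  isEven ((N ∸ j + j) + (N ∸ i + i))             ≡⟨ cong isEven (cong₂ _+_ (m∸n+n≡m j≤N) (m∸n+n≡m i≤N)) ⟩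
  isEven (N + N)                                 ≡⟨ isEven-+ N N ⟩
  isEven N ⇔ᵇ isEven N                           ≡⟨ ⇔ᵇ-refl (isEven N) ⟩
  true                                           ∎)
  where
  open ≡-Reasoning
  regroup : ∀ A B i j → A + B + (i + j) ≡ (A + j) + (B + i)
  regroup = solve-∀
  ⇔ᵇ-refl : ∀ x → (x ⇔ᵇ x) ≡ true
  ⇔ᵇ-refl true  = refl
  ⇔ᵇ-refl false = refl

-- The pair (i , j) contributes (-1)^(i+j) sign(σⱼ - σᵢ) = 2 [biP] - 1 to j(σ).
biP : PairPredicate
biP p x y = isEven (proj₁ p + proj₂ p) ⇔ᵇ (x <ᵇ y)

biP-balanced : ∀ n → Balanced n (λ σ → + pairStat (length σ) (at σ) biP (λ _ → 1))
biP-balanced n = pairStat-balanced n biP (λ _ → 1) exactlyOne complementSwaps reflectKeeps (λ _ _ → refl)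
  where
  exactlyOne : ∀ p → PosPair n p → ∀ x y → x ≢ y → toℕ (biP p x y) + toℕ (biP p y x) ≡ 1
  exactlyOne p _ x y x≢y rewrite <ᵇ-swap x≢y | ⇔ᵇ-not (isEven (proj₁ p + proj₂ p)) (x <ᵇ y) = toℕ-+-not (biP p x y)
  complementSwaps : ∀ p x y → x ≤ suc n → y ≤ suc n → biP p (suc n ∸ x) (suc n ∸ y) ≡ biP p y x
  complementSwaps p x y x≤ y≤ = cong (isEven (proj₁ p + proj₂ p) ⇔ᵇ_) (∸-<ᵇ-∸ (suc n) x≤ y≤)
  reflectKeeps : ∀ p → PosPair n p → ∀ x y → biP (reflectPair n p) x y ≡ biP p x y
  reflectKeeps (i , j) (_ , i<j , j≤n) x y = cong (_⇔ᵇ (x <ᵇ y))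
    (isEven-reflect (suc n) i j (m≤n⇒m≤1+n (≤-trans (<⇒≤ i<j) j≤n)) (m≤n⇒m≤1+n j≤n))

jStat-term : ∀ k x y → x ≢ y →
  altSign k ℤ.* signℤ y x ≡ + (2 * (if isEven k ⇔ᵇ (x <ᵇ y) then 1 else 0)) ℤ.- + 1
jStat-term k x y x≢y rewrite <ᵇ-swap x≢y with isEven k | x <ᵇ y
... | true  | true  = refl
... | true  | false = refl
... | false | true  = refl
... | false | false = refl

sumℤ-cong : {A : Set} (xs : List A) {f g : A → ℤ} → (∀ x → x ∈ xs → f x ≡ g x) → sumℤ (map f xs) ≡ sumℤ (map g xs)
sumℤ-cong []       f≗g = refl
sumℤ-cong (x ∷ xs) f≗g = cong₂ ℤ._+_ (f≗g x (here refl)) (sumℤ-cong xs (λ y y∈ → f≗g y (there y∈)))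

sumℤ-2*-1 : {A : Set} (xs : List A) (g : A → ℕ) →
  sumℤ (map (λ p → + (2 * g p) ℤ.- + 1) xs) ≡ + (2 * ∑ xs g) ℤ.- + length xs
sumℤ-2*-1 []       g = refl
sumℤ-2*-1 (x ∷ xs) g = begin
  (+ (2 * g x) ℤ.- + 1) ℤ.+ sumℤ (map (λ p → + (2 * g p) ℤ.- + 1) xs)  ≡⟨ cong (λ s → (+ (2 * g x) ℤ.- + 1) ℤ.+ s) (sumℤ-2*-1 xs g) ⟩
  (+ (2 * g x) ℤ.- + 1) ℤ.+ (+ (2 * ∑ xs g) ℤ.- + length xs)         ≡⟨ regroup (+ (2 * g x)) (+ (2 * ∑ xs g)) (+ length xs) ⟩
  (+ (2 * g x) ℤ.+ + (2 * ∑ xs g)) ℤ.- (+ 1 ℤ.+ + length xs)         ≡⟨ cong (λ s → + s ℤ.- + suc (length xs)) (sym (*-distribˡ-+ 2 (g x) (∑ xs g))) ⟩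
  + (2 * ∑ (x ∷ xs) g) ℤ.- + length (x ∷ xs)                        ∎
  where
  open ≡-Reasoning
  regroup : ∀ a b l → (a ℤ.- + 1) ℤ.+ (b ℤ.- l) ≡ (a ℤ.+ b) ℤ.- (+ 1 ℤ.+ l)
  regroup = ℤ-Solver.solve-∀

jStat≡ : ∀ {n} σ → length σ ≡ n → InjectiveOn n (at σ) →
  jStat σ ≡ + (2 * pairStat n (at σ) biP (λ _ → 1)) ℤ.- + length (posPairs n)
jStat≡ {n} σ refl at-inj = trans
  (sumℤ-cong (posPairs n) (λ { (i , j) ij∈ → let (1≤i , i<j , j≤n) = ∈-posPairs⁻ n (i , j) ij∈ in
    jStat-term (i + j) (at σ i) (at σ j)
      (at-inj i j 1≤i (≤-trans (<⇒≤ i<j) j≤n) (≤-trans 1≤i (<⇒≤ i<j)) j≤n (λ i≡j → <-irrefl i≡j i<j)) }))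
  (sumℤ-2*-1 (posPairs n) (λ p → if biP p (at σ (proj₁ p)) (at σ (proj₂ p)) then 1 else 0))

-- Division by 2 rounds towards -∞, so an even summand can be pulled out of the numerator.
neg-suc+1 : ∀ q → ℤ.- (+ suc q) ℤ.+ + 1 ≡ ℤ.- (+ q)
neg-suc+1 zero    = refl
neg-suc+1 (suc q) = refl

[3+k]/2 : ∀ k → suc (suc (suc k)) ℕ./ 2 ≡ suc (suc k ℕ./ 2)
[3+k]/2 k = m/n≡1+[m∸n]/n {suc (suc (suc k))} {2} (s≤s (s≤s z≤n))

[x+2]/ℕ2 : ∀ x → (x ℤ.+ + 2) /ℕ 2 ≡ (x /ℕ 2) ℤ.+ + 1
[x+2]/ℕ2 (+ k) = cong +_ (trans (m/n≡1+[m∸n]/n {k + 2} {2} (m≤n+m 2 k))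
  (trans (cong (λ z → suc (z ℕ./ 2)) (m+n∸n≡m k 2)) (+-comm 1 (k ℕ./ 2))))
[x+2]/ℕ2 -[1+ zero ]        = refl
[x+2]/ℕ2 -[1+ suc zero ]    = refl
[x+2]/ℕ2 -[1+ suc (suc k) ] with suc k ℕ.% 2
... | zero  = sym (trans (cong (λ z → ℤ.- (+ z) ℤ.+ + 1) ([3+k]/2 k)) (neg-suc+1 (suc k ℕ./ 2)))
... | suc r = sym (cong (λ z → -[1+ z ] ℤ.+ + 1) ([3+k]/2 k))

[2c+x]/ℕ2 : ∀ c x → (+ (2 * c) ℤ.+ x) /ℕ 2 ≡ + c ℤ.+ (x /ℕ 2)
[2c+x]/ℕ2 zero    x = trans (cong (_/ℕ 2) (ℤP.+-identityˡ x)) (sym (ℤP.+-identityˡ (x /ℕ 2)))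
[2c+x]/ℕ2 (suc c) x = begin
  (+ (2 * suc c) ℤ.+ x) /ℕ 2         ≡⟨ cong (λ z → (+ z ℤ.+ x) /ℕ 2) (*-suc 2 c) ⟩
  (+ 2 ℤ.+ + (2 * c) ℤ.+ x) /ℕ 2     ≡⟨ cong (_/ℕ 2) (regroup (+ 2) (+ (2 * c)) x) ⟩
  ((+ (2 * c) ℤ.+ x) ℤ.+ + 2) /ℕ 2   ≡⟨ [x+2]/ℕ2 (+ (2 * c) ℤ.+ x) ⟩
  ((+ (2 * c) ℤ.+ x) /ℕ 2) ℤ.+ + 1   ≡⟨ cong (ℤ._+ + 1) ([2c+x]/ℕ2 c x) ⟩
  + c ℤ.+ (x /ℕ 2) ℤ.+ + 1           ≡⟨ regroup′ (+ c) (x /ℕ 2) ⟩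
  + suc c ℤ.+ (x /ℕ 2)               ∎
  where
  open ≡-Reasoning
  regroup : ∀ a b d → a ℤ.+ b ℤ.+ d ≡ (b ℤ.+ d) ℤ.+ a
  regroup = ℤ-Solver.solve-∀
  regroup′ : ∀ a d → a ℤ.+ d ℤ.+ + 1 ≡ (+ 1 ℤ.+ a) ℤ.+ d
  regroup′ = ℤ-Solver.solve-∀

biAltOffset : ℕ → ℤ
biAltOffset n = (+ ((n ℕ./ 2) * (n ℕ./ 2)) ℤ.- + length (posPairs n)) /ℕ 2

biAltInversions≡ : ∀ {n} σ → length σ ≡ n → InjectiveOn n (at σ) →
  biAltInversions σ ≡ biAltOffset n ℤ.+ + 1 ℤ.* + pairStat n (at σ) biP (λ _ → 1)
biAltInversions≡ {n} σ refl at-inj = begin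
  (jStat σ ℤ.+ + h²) /ℕ 2                    ≡⟨ cong (λ z → (z ℤ.+ + h²) /ℕ 2) (jStat≡ σ refl at-inj) ⟩
  (+ (2 * c) ℤ.- + N ℤ.+ + h²) /ℕ 2          ≡⟨ cong (_/ℕ 2) (regroup (+ (2 * c)) (+ N) (+ h²)) ⟩
  (+ (2 * c) ℤ.+ (+ h² ℤ.- + N)) /ℕ 2        ≡⟨ [2c+x]/ℕ2 c (+ h² ℤ.- + N) ⟩
  + c ℤ.+ (+ h² ℤ.- + N) /ℕ 2                ≡⟨ regroup′ (+ c) ((+ h² ℤ.- + N) /ℕ 2) ⟩
  (+ h² ℤ.- + N) /ℕ 2 ℤ.+ + 1 ℤ.* + c        ∎
  where
  open ≡-Reasoning
  h² = (n ℕ./ 2) * (n ℕ./ 2)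
  N  = length (posPairs n)
  c  = pairStat n (at σ) biP (λ _ → 1)
  regroup : ∀ a p m → a ℤ.- p ℤ.+ m ≡ a ℤ.+ (m ℤ.- p)
  regroup = ℤ-Solver.solve-∀
  regroup′ : ∀ a d → a ℤ.+ d ≡ d ℤ.+ + 1 ℤ.* a
  regroup′ = ℤ-Solver.solve-∀

biAltInversions-balanced : ∀ n → Balanced n biAltInversions
biAltInversions-balanced n = Balanced-resp
  (λ σ p → let g = arrangement p in sym (biAltInversions≡ σ (Arrangement.length≡ g) (Arrangement.at-inj g)))
  (Balanced-affine (biAltOffset n) (+ 1) (Balanced-resp
    (λ σ p → cong (λ m → + pairStat m (at σ) biP (λ _ → 1)) (Arrangement.length≡ (arrangement p)))
    (biP-balanced n)))

-- Descents, runs, cyclic descents and the permutation tree: (10)–(17)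

descentsAt≡∑ : ∀ d σ → descentsAt d σ ≡ ∑ (oneTo (length σ ∸ d)) (λ i → toℕ (at σ (i + d) <ᵇ at σ i))
descentsAt≡∑ d σ = countB≡∑ _ (oneTo (length σ ∸ d))

ascentsAt+descentsAt : ∀ d σ → ascentsAt d σ + descentsAt d σ ≡ length σ ∸ d
ascentsAt+descentsAt d σ = trans (cong₂ _+_ (countB≡∑ _ (oneTo (length σ ∸ d))) (descentsAt≡∑ d σ))
  (∑-oneTo-complementary (length σ ∸ d) _ _ (λ i _ _ → let b = at σ (i + d) <ᵇ at σ i in trans (+-comm (toℕ (not b)) (toℕ b)) (toℕ-+-not b)))

1≤m≤n∸o⇒o<n : ∀ {m n o} → 1 ≤ m → m ≤ n ∸ o → o < n
1≤m≤n∸o⇒o<n {m} {n} {o} 1≤m m≤ = m∸n≢0⇒n<m (λ n∸o≡0 → <-irrefl refl (≤-trans 1≤m (subst (m ≤_) n∸o≡0 m≤)))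

-- The d-descent of revMap σ at suc (n ∸ d) ∸ i compares the same two entries as that of σ at i.
reflectDistance : ∀ n d i → 1 ≤ i → i ≤ n ∸ d →
  (suc n ∸ ((suc (n ∸ d) ∸ i) + d) ≡ i) × (suc n ∸ (suc (n ∸ d) ∸ i) ≡ i + d)
reflectDistance n d i 1≤i i≤ with m≤n⇒∃[o]m+o≡n {d} {n} (<⇒≤ (1≤m≤n∸o⇒o<n {i} {n} {d} 1≤i i≤))
... | m , refl with m≤n⇒∃[o]m+o≡n (subst (i ≤_) (m+n∸m≡n d m) i≤)
... | k , refl rewrite m+n∸m≡n d (i + k) | sym (+-suc i k) | m+n∸m≡n i (suc k) =
  trans (cong (_∸ (suc k + d)) (e₁ d i k)) (m+n∸n≡m i (suc k + d)) ,
  trans (cong (_∸ suc k) (e₂ d i k)) (m+n∸n≡m (i + d) (suc k))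
  where
  e₁ : ∀ d i k → suc (d + (i + k)) ≡ i + (suc k + d)
  e₁ = solve-∀
  e₂ : ∀ d i k → suc (d + (i + k)) ≡ (i + d) + suc k
  e₂ = solve-∀

module _ {n σ} (g : Arrangement n σ) {d} (1≤d : 1 ≤ d) where
  open Arrangement g

  private
    descent+ascent : ∀ i → 1 ≤ i → i ≤ n ∸ d → ∀ {b} → b ≡ (at σ i <ᵇ at σ (i + d)) →
      toℕ (at σ (i + d) <ᵇ at σ i) + toℕ b ≡ 1
    descent+ascent i 1≤i i≤ refl = <ᵇ-+-swap (at-inj (i + d) i (≤-trans 1≤i (m≤m+n i d)) i+d≤n 1≤i (≤-trans (m≤m+n i d) i+d≤n) i+d≢i)
      where
      i+d≤n : i + d ≤ n
      i+d≤n = m≤o∸n⇒m+n≤o i (<⇒≤ (1≤m≤n∸o⇒o<n 1≤i i≤)) i≤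
      i+d≢i : i + d ≢ i
      i+d≢i i+d≡i = <-irrefl (sym i+d≡i) (subst (_< i + d) (+-identityʳ i) (+-monoʳ-< i 1≤d))

  descentsAt-compMap : descentsAt d σ + descentsAt d (compMap n σ) ≡ n ∸ d
  descentsAt-compMap rewrite descentsAt≡∑ d σ | descentsAt≡∑ d (compMap n σ) | length-compMap g | length≡ =
    ∑-oneTo-complementary (n ∸ d) _ _ (λ i 1≤i i≤ → let i+d≤n = m≤o∸n⇒m+n≤o i (<⇒≤ (1≤m≤n∸o⇒o<n 1≤i i≤)) i≤ in
      descent+ascent i 1≤i i≤ (begin
        at (compMap n σ) (i + d) <ᵇ at (compMap n σ) i  ≡⟨ cong₂ _<ᵇ_ (at-compMap g (i + d) (≤-trans 1≤i (m≤m+n i d)) i+d≤n)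
                                                                     (at-compMap g i 1≤i (≤-trans (m≤m+n i d) i+d≤n)) ⟩
        suc n ∸ at σ (i + d) <ᵇ suc n ∸ at σ i          ≡⟨ ∸-<ᵇ-∸ (suc n) (at≤1+n (i + d) (≤-trans 1≤i (m≤m+n i d)) i+d≤n)
                                                                     (at≤1+n i 1≤i (≤-trans (m≤m+n i d) i+d≤n)) ⟩
        at σ i <ᵇ at σ (i + d)                          ∎))
    where open ≡-Reasoning

  descentsAt-revMap : descentsAt d σ + descentsAt d (revMap σ) ≡ n ∸ d
  descentsAt-revMap rewrite descentsAt≡∑ d σ | descentsAt≡∑ d (revMap σ) | length-revMap g | length≡
    | ∑-oneTo-reflect (n ∸ d) (λ i → toℕ (at (revMap σ) (i + d) <ᵇ at (revMap σ) i)) =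
    ∑-oneTo-complementary (n ∸ d) _ _ (λ i 1≤i i≤ →
      let j    = suc (n ∸ d) ∸ i
          1≤j  = m<n⇒0<n∸m (s≤s i≤)
          j≤   = ∸-monoʳ-≤ (suc (n ∸ d)) 1≤i
          j+d≤n = m≤o∸n⇒m+n≤o j (<⇒≤ (1≤m≤n∸o⇒o<n 1≤j j≤)) j≤
      in descent+ascent i 1≤i i≤ (cong₂ _<ᵇ_
        (trans (at-revMap g (j + d) (≤-trans 1≤j (m≤m+n j d)) j+d≤n) (cong (at σ) (proj₁ (reflectDistance n d i 1≤i i≤))))
        (trans (at-revMap g j 1≤j (≤-trans (m≤m+n j d) j+d≤n)) (cong (at σ) (proj₂ (reflectDistance n d i 1≤i i≤))))))

descentsAt-balanced : ∀ n d → 1 ≤ d → Balanced n (λ σ → + descentsAt d σ)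
descentsAt-balanced n d 1≤d =
  pairSumℕ (λ σ p → descentsAt-revMap (arrangement p) 1≤d) , pairSumℕ (λ σ p → descentsAt-compMap (arrangement p) 1≤d)

ascentsAt-balanced : ∀ n d → 1 ≤ d → Balanced n (λ σ → + ascentsAt d σ)
ascentsAt-balanced n d 1≤d = Balanced-resp ascentsAt≡ (Balanced-affine (+ (n ∸ d)) (ℤ.- + 1) (descentsAt-balanced n d 1≤d))
  where
  ascentsAt≡ : ∀ σ → Perm n σ → + (n ∸ d) ℤ.+ ℤ.- + 1 ℤ.* + descentsAt d σ ≡ + ascentsAt d σ
  ascentsAt≡ σ p = begin
    + (n ∸ d) ℤ.+ ℤ.- + 1 ℤ.* + descentsAt d σ            ≡⟨ cong (λ m → + (m ∸ d) ℤ.+ ℤ.- + 1 ℤ.* + descentsAt d σ)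
                                                               (sym (Arrangement.length≡ (arrangement p))) ⟩
    + (length σ ∸ d) ℤ.+ ℤ.- + 1 ℤ.* + descentsAt d σ     ≡⟨ cong (λ m → + m ℤ.+ ℤ.- + 1 ℤ.* + descentsAt d σ) (sym (ascentsAt+descentsAt d σ)) ⟩
    (+ ascentsAt d σ ℤ.+ + descentsAt d σ) ℤ.+ ℤ.- + 1 ℤ.* + descentsAt d σ  ≡⟨ cancel (+ ascentsAt d σ) (+ descentsAt d σ) ⟩
    + ascentsAt d σ                                       ∎
    where
    open ≡-Reasoning
    cancel : ∀ a b → (a ℤ.+ b) ℤ.+ ℤ.- + 1 ℤ.* b ≡ a
    cancel = ℤ-Solver.solve-∀

descentsAt-∷-∷ : ∀ x y zs → descentsAt 1 (x ∷ y ∷ zs) ≡ toℕ (y <ᵇ x) + descentsAt 1 (y ∷ zs)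
descentsAt-∷-∷ x y zs = trans (descentsAt≡∑ 1 (x ∷ y ∷ zs)) (trans (∑-oneTo-suc (length zs) _)
  (cong (λ s → toℕ (y <ᵇ x) + s) (trans (∑-oneTo-cong (length zs) (λ i 1≤i _ →
      cong₂ (λ a b → toℕ (a <ᵇ b)) (at-cons x (y ∷ zs) (i + 1) (≤-trans 1≤i (m≤m+n i 1))) (at-cons x (y ∷ zs) i 1≤i)))
    (sym (descentsAt≡∑ 1 (y ∷ zs))))))

runsOf-length : ∀ σ → Unique σ → σ ≢ [] → length (runsOf σ) ≡ suc (descentsAt 1 σ)
runsOf-length []           _               σ≢[] = ⊥-elim (σ≢[] refl)
runsOf-length (x ∷ [])     _               _    = refl
runsOf-length (x ∷ y ∷ zs) ((x≢y ∷ _) ∷ u) _ rewrite descentsAt-∷-∷ x y zs | <ᵇ-swap x≢y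
  with x <ᵇ y | runsOf (y ∷ zs) | runsOf-length (y ∷ zs) u (λ ())
... | true  | r ∷ rs | ih = ih
... | false | r ∷ rs | ih = cong suc ih

dropWhile-⊆ : ∀ x st {v} → v ∈ dropWhile (x ℕ.≤?_) st → v ∈ st
dropWhile-⊆ x (s ∷ st) v∈ with x ≤ᵇ s
... | true  = there (dropWhile-⊆ x st v∈)
... | false = v∈

0∈dropWhile : ∀ x st → 1 ≤ x → 0 ∈ st → 0 ∈ dropWhile (x ℕ.≤?_) st
0∈dropWhile x (s ∷ st) 1≤x 0∈ with x ≤ᵇ s in x≤s
0∈dropWhile x (s ∷ st) 1≤x (here refl) | true  = ⊥-elim (<⇒≱ 1≤x (≤ᵇ⇒≤ x 0 (subst T (sym x≤s) _)))
0∈dropWhile x (s ∷ st) 1≤x (there 0∈)  | true  = 0∈dropWhile x st 1≤x 0∈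
... | false = 0∈

dropWhile-< : ∀ x y L → x < y → dropWhile (y ℕ.≤?_) (x ∷ L) ≡ x ∷ L
dropWhile-< x y L x<y rewrite ¬T⇒≡false {y ≤ᵇ x} (λ t → <⇒≱ x<y (≤ᵇ⇒≤ y x t)) = refl

dropWhile-> : ∀ x y L → y < x → dropWhile (y ℕ.≤?_) (x ∷ L) ≡ dropWhile (y ℕ.≤?_) L
dropWhile-> x y L y<x rewrite T⇒≡true (≤⇒≤ᵇ (<⇒≤ y<x)) = refl

hasChild-fresh : ∀ st xs v → v ∉ st → v ∉ xs → hasChild (treeEdges st xs) v ≡ false
hasChild-fresh st []       v _    _    = refl
hasChild-fresh st (x ∷ xs) v v∉st v∉xs with dropWhile (x ℕ.≤?_) st in eq
... | []       = refl
... | p ∷ rest rewrite ≡ᵇ-false (λ p≡v → v∉st (subst (_∈ st) p≡v (dropWhile-⊆ x st (subst (p ∈_) (sym eq) (here refl))))) =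
  hasChild-fresh (x ∷ p ∷ rest) xs v v∉stack (λ v∈ → v∉xs (there v∈))
  where
  v∉stack : v ∉ x ∷ p ∷ rest
  v∉stack (here v≡x) = v∉xs (here v≡x)
  v∉stack (there v∈) = v∉st (dropWhile-⊆ x st (subst (v ∈_) (sym eq) v∈))

hasChild-ascent : ∀ x y L zs → x < y → hasChild (treeEdges (x ∷ L) (y ∷ zs)) x ≡ true
hasChild-ascent x y L zs x<y rewrite dropWhile-< x y L x<y | ≡ᵇ-refl x = refl

hasChild-descent : ∀ x y L zs → y < x → x ∉ L → x ∉ zs → hasChild (treeEdges (x ∷ L) (y ∷ zs)) x ≡ false
hasChild-descent x y L zs y<x x∉L x∉zs rewrite dropWhile-> x y L y<x with dropWhile (y ℕ.≤?_) L in eq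
... | []    = refl
... | p ∷ r rewrite ≡ᵇ-false (λ p≡x → x∉L (subst (_∈ L) p≡x (dropWhile-⊆ y L (subst (p ∈_) (sym eq) (here refl))))) =
  hasChild-fresh (y ∷ p ∷ r) zs x x∉stack x∉zs
  where
  x∉stack : x ∉ y ∷ p ∷ r
  x∉stack (here x≡y) = <-irrefl (sym x≡y) y<x
  x∉stack (there x∈) = x∉L (dropWhile-⊆ y L (subst (x ∈_) (sym eq) x∈))

-- Inserting x makes it the top of the stack; it gets a child exactly when the next value is larger,
-- and is popped for good otherwise.  So every descent, and the last value, yields one leaf.
leaves-treeEdges : ∀ st xs → Unique xs → All (1 ≤_) xs → All (_∉ st) xs → 0 ∈ st → xs ≢ [] →
  ∑ xs (λ v → toℕ (not (hasChild (treeEdges st xs) v))) ≡ suc (descentsAt 1 xs)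
leaves-treeEdges st []       _          _           _            _   xs≢[] = ⊥-elim (xs≢[] refl)
leaves-treeEdges st (x ∷ xs) (x∉xs ∷ u) (1≤x ∷ pos) (x∉st ∷ fresh) 0∈st _ with dropWhile (x ℕ.≤?_) st in eq
... | [] with () ← subst (0 ∈_) eq (0∈dropWhile x st 1≤x 0∈st)
... | p ∷ rest = trans
  (∑-cong (x ∷ xs) (λ v v∈ → cong (λ b → toℕ (not (b ∨ hasChild (treeEdges (x ∷ p ∷ rest) xs) v))) (≡ᵇ-false (p≢ v v∈))))
  (afterInsert xs x∉xs u pos fresh)
  where
  ∈stack⇒∈st : ∀ {v} → v ∈ p ∷ rest → v ∈ st
  ∈stack⇒∈st v∈ = dropWhile-⊆ x st (subst (_ ∈_) (sym eq) v∈)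
  p≢ : ∀ v → v ∈ x ∷ xs → p ≢ v
  p≢ v (here refl) p≡x = x∉st (subst (_∈ st) p≡x (∈stack⇒∈st (here refl)))
  p≢ v (there v∈)  p≡v = All.lookup fresh v∈ (subst (_∈ st) p≡v (∈stack⇒∈st (here refl)))
  afterInsert : ∀ xs → All (x ≢_) xs → Unique xs → All (1 ≤_) xs → All (_∉ st) xs →
    ∑ (x ∷ xs) (λ v → toℕ (not (hasChild (treeEdges (x ∷ p ∷ rest) xs) v))) ≡ suc (descentsAt 1 (x ∷ xs))
  afterInsert []       _   _ _   _     = refl
  afterInsert (y ∷ zs) x∉ u pos fresh′ = begin
    toℕ (not (hasChild (treeEdges (x ∷ p ∷ rest) (y ∷ zs)) x)) + ∑ (y ∷ zs) _
      ≡⟨ cong₂ _+_ leaf-x (leaves-treeEdges (x ∷ p ∷ rest) (y ∷ zs) u pos (All.tabulate fresh″)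
           (there (subst (0 ∈_) eq (0∈dropWhile x st 1≤x 0∈st))) (λ ())) ⟩
    toℕ (y <ᵇ x) + suc (descentsAt 1 (y ∷ zs))   ≡⟨ +-suc (toℕ (y <ᵇ x)) _ ⟩
    suc (toℕ (y <ᵇ x) + descentsAt 1 (y ∷ zs))   ≡⟨ cong suc (sym (descentsAt-∷-∷ x y zs)) ⟩
    suc (descentsAt 1 (x ∷ y ∷ zs))              ∎
    where
    open ≡-Reasoning
    fresh″ : ∀ {v} → v ∈ y ∷ zs → v ∉ x ∷ p ∷ rest
    fresh″ v∈ (here v≡x) = All.lookup x∉ v∈ (sym v≡x)
    fresh″ v∈ (there v∈′) = All.lookup fresh′ v∈ (∈stack⇒∈st v∈′)
    leaf-x : toℕ (not (hasChild (treeEdges (x ∷ p ∷ rest) (y ∷ zs)) x)) ≡ toℕ (y <ᵇ x)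
    leaf-x with <-cmp x y
    ... | tri< x<y _ _ rewrite hasChild-ascent x y (p ∷ rest) zs x<y | <ᵇ-false (<⇒≤ x<y) = refl
    ... | tri≈ _ x≡y _ = ⊥-elim (All.lookup x∉ (here refl) x≡y)
    ... | tri> _ _ y<x rewrite hasChild-descent x y (p ∷ rest) zs y<x (λ x∈ → x∉st (∈stack⇒∈st x∈))
                                 (λ x∈ → All.lookup x∉ (there x∈) refl) | <ᵇ-true y<x = refl

root-hasChild : ∀ x xs → 1 ≤ x → hasChild (treeEdges (0 ∷ []) (x ∷ xs)) 0 ≡ true
root-hasChild (suc x) xs _ = refl

treeWidth≡suc : ∀ {n σ} → Perm n σ → σ ≢ [] → treeWidth σ ≡ + suc (descentsAt 1 σ)
treeWidth≡suc {σ = []}     _ σ≢[] = ⊥-elim (σ≢[] refl)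
treeWidth≡suc {n} {x ∷ xs} p _    = cong +_ (begin
  countB (λ v → not (hasChild E v)) (upTo (suc (length (x ∷ xs))))
    ≡⟨ countB≡∑ (λ v → not (hasChild E v)) (upTo (suc (length (x ∷ xs)))) ⟩
  toℕ (not (hasChild E 0)) + ∑ (applyUpTo suc (length (x ∷ xs))) leaf
    ≡⟨ cong₂ _+_ (cong (toℕ ∘ not) (root-hasChild x xs (proj₁ (∈-range x (here refl)))))
                 (cong (λ l → ∑ l leaf) (sym (map-upTo suc (length (x ∷ xs))))) ⟩
  ∑ (oneTo (length (x ∷ xs))) leaf
    ≡⟨ cong (λ m → ∑ (oneTo m) leaf) length≡ ⟩
  ∑ (oneTo n) leaf
    ≡⟨ sym (sum-↭ (map⁺ leaf p)) ⟩
  ∑ (x ∷ xs) leaf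
    ≡⟨ leaves-treeEdges (0 ∷ []) (x ∷ xs) unique (All.tabulate (λ v∈ → proj₁ (∈-range _ v∈)))
         (All.tabulate (λ { v∈ (here refl) → <-irrefl refl (proj₁ (∈-range _ v∈)) })) (here refl) (λ ()) ⟩
  suc (descentsAt 1 (x ∷ xs)) ∎)
  where
  open ≡-Reasoning
  open Arrangement (arrangement p)
  E = permTreeEdges (x ∷ xs)
  leaf : ℕ → ℕ
  leaf v = toℕ (not (hasChild E v))

module _ {n σ} (p : Perm n σ) (1≤n : 1 ≤ n) where
  open Arrangement (arrangement p)

  σ≢[] : σ ≢ []
  σ≢[] refl = <-irrefl length≡ 1≤n

  runs≡ : runs σ ≡ + 1 ℤ.+ + 1 ℤ.* descents σ
  runs≡ = trans (cong +_ (runsOf-length σ unique σ≢[])) (cong (ℤ._+_ (+ 1)) (sym (ℤP.*-identityˡ (descents σ))))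

  treeWidth≡ : treeWidth σ ≡ + 1 ℤ.+ + 1 ℤ.* descents σ
  treeWidth≡ = trans (treeWidth≡suc p σ≢[]) (cong (ℤ._+_ (+ 1)) (sym (ℤP.*-identityˡ (descents σ))))

wrap : List ℕ → ℕ
wrap σ = if at σ (length σ) <ᵇ at σ 1 then 1 else 0

wrap-+-swapped : ∀ n (a : ℕ → ℕ) → 1 ≤ n → InjectiveOn n a →
  (if a n <ᵇ a 1 then 1 else 0) + (if a 1 <ᵇ a n then 1 else 0) ≡ toℕ (1 <ᵇ n)
wrap-+-swapped (suc zero)    a _ _ rewrite <ᵇ-false {a 1} ≤-refl = refl
wrap-+-swapped (suc (suc m)) a _ a-inj rewrite if≡toℕ (a (suc (suc m)) <ᵇ a 1) | if≡toℕ (a 1 <ᵇ a (suc (suc m))) =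
  <ᵇ-+-swap (a-inj (suc (suc m)) 1 (s≤s z≤n) ≤-refl (s≤s z≤n) (s≤s z≤n) (λ ()))

module _ {n σ} (g : Arrangement n σ) (1≤n : 1 ≤ n) where
  open Arrangement g

  wrap-revMap : wrap σ + wrap (revMap σ) ≡ toℕ (1 <ᵇ n)
  wrap-revMap rewrite length-revMap g | length≡ | at-revMap g n 1≤n ≤-refl | at-revMap g 1 ≤-refl 1≤n
    | m+n∸n≡m 1 n = wrap-+-swapped n (at σ) 1≤n at-inj

  wrap-compMap : wrap σ + wrap (compMap n σ) ≡ toℕ (1 <ᵇ n)
  wrap-compMap rewrite length-compMap g | length≡ | at-compMap g n 1≤n ≤-refl | at-compMap g 1 ≤-refl 1≤n
    | ∸-<ᵇ-∸ (suc n) (at≤1+n n 1≤n ≤-refl) (at≤1+n 1 ≤-refl 1≤n) = wrap-+-swapped n (at σ) 1≤n at-inj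

wrap-balanced : ∀ n → 1 ≤ n → Balanced n (λ σ → + wrap σ)
wrap-balanced n 1≤n = pairSumℕ (λ σ p → wrap-revMap (arrangement p) 1≤n) , pairSumℕ (λ σ p → wrap-compMap (arrangement p) 1≤n)

-- Cosine and Spearman's rho: (18), (22)

cos : List ℕ → ℕ
cos σ = ∑ (oneTo (length σ)) (λ i → i * at σ i)

module _ {n σ} (g : Arrangement n σ) where
  open Arrangement g

  cos-compMap : cos σ + cos (compMap n σ) ≡ ∑ (oneTo n) (λ i → i * suc n)
  cos-compMap rewrite length-compMap g | length≡ = trans (∑-+ (oneTo n) _ _) (∑-oneTo-cong n (λ i 1≤i i≤n → begin
    i * at σ i + i * at (compMap n σ) i     ≡⟨ cong (λ v → i * at σ i + i * v) (at-compMap g i 1≤i i≤n) ⟩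
    i * at σ i + i * (suc n ∸ at σ i)       ≡⟨ sym (*-distribˡ-+ i (at σ i) (suc n ∸ at σ i)) ⟩
    i * (at σ i + (suc n ∸ at σ i))         ≡⟨ cong (i *_) (m+[n∸m]≡n (at≤1+n i 1≤i i≤n)) ⟩
    i * suc n                               ∎))
    where open ≡-Reasoning

  cos-revMap : cos σ + cos (revMap σ) ≡ ∑ (oneTo n) (λ v → suc n * v)
  cos-revMap rewrite length-revMap g | length≡ = begin
    ∑ (oneTo n) (λ i → i * at σ i) + ∑ (oneTo n) (λ i → i * at (revMap σ) i)
      ≡⟨ cong (λ s → ∑ (oneTo n) (λ i → i * at σ i) + s) (∑-oneTo-reflect n _) ⟩
    ∑ (oneTo n) (λ i → i * at σ i) + ∑ (oneTo n) (λ i → (suc n ∸ i) * at (revMap σ) (suc n ∸ i))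
      ≡⟨ cong (λ s → ∑ (oneTo n) (λ i → i * at σ i) + s) (∑-oneTo-cong n (λ i 1≤i i≤n →
           cong ((suc n ∸ i) *_) (reflected i 1≤i i≤n))) ⟩
    ∑ (oneTo n) (λ i → i * at σ i) + ∑ (oneTo n) (λ i → (suc n ∸ i) * at σ i)
      ≡⟨ ∑-+ (oneTo n) _ _ ⟩
    ∑ (oneTo n) (λ i → i * at σ i + (suc n ∸ i) * at σ i)
      ≡⟨ ∑-oneTo-cong n (λ i _ i≤n → trans (sym (*-distribʳ-+ (at σ i) i (suc n ∸ i))) (cong (_* at σ i) (m+[n∸m]≡n (m≤n⇒m≤1+n i≤n)))) ⟩
    ∑ (oneTo n) (λ i → suc n * at σ i)
      ≡⟨ ∑-values (suc n *_) ⟩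
    ∑ (oneTo n) (λ v → suc n * v) ∎
    where
    open ≡-Reasoning
    reflected : ∀ i → 1 ≤ i → i ≤ n → at (revMap σ) (suc n ∸ i) ≡ at σ i
    reflected i 1≤i i≤n = trans (at-revMap g (suc n ∸ i) (m<n⇒0<n∸m (s≤s i≤n)) (∸-monoʳ-≤ (suc n) 1≤i))
      (cong (at σ) (m∸[m∸n]≡n (m≤n⇒m≤1+n i≤n)))

cosine-balanced : ∀ n → Balanced n cosine
cosine-balanced n = pairSumℕ (λ σ p → cos-revMap (arrangement p)) , pairSumℕ (λ σ p → cos-compMap (arrangement p))

sumℤ-sub : {A : Set} (xs : List A) (f g : A → ℕ) → sumℤ (map (λ x → + f x ℤ.- + g x) xs) ≡ + ∑ xs f ℤ.- + ∑ xs g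
sumℤ-sub []       f g = refl
sumℤ-sub (x ∷ xs) f g = trans (cong (λ s → (+ f x ℤ.- + g x) ℤ.+ s) (sumℤ-sub xs f g))
  (regroup (+ f x) (+ g x) (+ ∑ xs f) (+ ∑ xs g))
  where
  regroup : ∀ a b c d → (a ℤ.- b) ℤ.+ (c ℤ.- d) ≡ (a ℤ.+ c) ℤ.- (b ℤ.+ d)
  regroup = ℤ-Solver.solve-∀

[x-i]² : ∀ x i → (+ x ℤ.- + i) ℤ.* (+ x ℤ.- + i) ≡ + (x * x + i * i) ℤ.- + (2 * (i * x))
[x-i]² x i = trans (square (+ x) (+ i)) (sym (cong₂ ℤ._-_
  (trans (ℤP.pos-+ (x * x) (i * i)) (cong₂ ℤ._+_ (ℤP.pos-* x x) (ℤP.pos-* i i)))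
  (trans (ℤP.pos-* 2 (i * x)) (cong (ℤ._*_ (+ 2)) (ℤP.pos-* i x)))))
  where
  square : ∀ X I → (X ℤ.- I) ℤ.* (X ℤ.- I) ≡ (X ℤ.* X ℤ.+ I ℤ.* I) ℤ.- + 2 ℤ.* (I ℤ.* X)
  square = ℤ-Solver.solve-∀

-- Σ (σᵢ - i)² = 2 Σ i² - 2 cos σ, because σ only permutes the values i.
spearmanRho≡ : ∀ {n σ} → Arrangement n σ →
  spearmanRho σ ≡ + (2 * ∑ (oneTo n) (λ i → i * i)) ℤ.+ ℤ.- + 2 ℤ.* cosine σ
spearmanRho≡ {n} {σ} g rewrite Arrangement.length≡ g = begin
  sumℤ (map (λ i → (+ at σ i ℤ.- + i) ℤ.* (+ at σ i ℤ.- + i)) (oneTo n))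
    ≡⟨ sumℤ-cong (oneTo n) (λ i _ → [x-i]² (at σ i) i) ⟩
  sumℤ (map (λ i → + (at σ i * at σ i + i * i) ℤ.- + (2 * (i * at σ i))) (oneTo n))
    ≡⟨ sumℤ-sub (oneTo n) _ _ ⟩
  + ∑ (oneTo n) (λ i → at σ i * at σ i + i * i) ℤ.- + ∑ (oneTo n) (λ i → 2 * (i * at σ i))
    ≡⟨ cong₂ (λ a b → + a ℤ.- + b) squares (∑-*ˡ (oneTo n) 2 (λ i → i * at σ i)) ⟩
  + (2 * Q) ℤ.- + (2 * c)
    ≡⟨ cong (λ z → + (2 * Q) ℤ.- z) (ℤP.pos-* 2 c) ⟩
  + (2 * Q) ℤ.- + 2 ℤ.* + c
    ≡⟨ cong (λ z → + (2 * Q) ℤ.+ z) (ℤP.neg-distribˡ-* (+ 2) (+ c)) ⟩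
  + (2 * Q) ℤ.+ ℤ.- + 2 ℤ.* + c ∎
  where
  open ≡-Reasoning
  Q = ∑ (oneTo n) (λ i → i * i)
  c = ∑ (oneTo n) (λ i → i * at σ i)
  squares : ∑ (oneTo n) (λ i → at σ i * at σ i + i * i) ≡ 2 * Q
  squares = trans (sym (∑-+ (oneTo n) _ _)) (trans (cong (_+ Q) (Arrangement.∑-values g (λ v → v * v)))
    (cong (λ s → Q + s) (sym (+-identityʳ Q))))

spearmanRho-balanced : ∀ n → Balanced n spearmanRho
spearmanRho-balanced n = Balanced-resp (λ σ p → sym (spearmanRho≡ (arrangement p)))
  (Balanced-affine (+ (2 * ∑ (oneTo n) (λ i → i * i))) (ℤ.- + 2) (cosine-balanced n))

-- Recoils: (19)

posOf-head : ∀ x xs → posOf (x ∷ xs) x ≡ 1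
posOf-head x xs rewrite ≡ᵇ-refl x = refl

posOf-positive : ∀ xs v → v ∈ xs → 1 ≤ posOf xs v
posOf-positive (x ∷ xs) v v∈ with x ≡ᵇ v in x≡ᵇv
... | true = s≤s z≤n
posOf-positive (x ∷ xs) v (here refl) | false with () ← trans (sym x≡ᵇv) (≡ᵇ-refl x)
posOf-positive (x ∷ xs) v (there v∈) | false with posOf xs v | posOf-positive xs v v∈
... | suc k | _ = s≤s z≤n

posOf-∷ : ∀ x xs v → x ≢ v → v ∈ xs → posOf (x ∷ xs) v ≡ suc (posOf xs v)
posOf-∷ x xs v x≢v v∈ rewrite ≡ᵇ-false x≢v with posOf xs v | posOf-positive xs v v∈
... | suc k | _ = refl

posOf≤length : ∀ xs v → v ∈ xs → posOf xs v ≤ length xs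
posOf≤length (x ∷ xs) v v∈ with x ℕ.≟ v
... | yes refl rewrite posOf-head x xs = s≤s z≤n
... | no x≢v with v∈
...   | here v≡x  = ⊥-elim (x≢v (sym v≡x))
...   | there v∈′ rewrite posOf-∷ x xs v x≢v v∈′ = s≤s (posOf≤length xs v v∈′)

at-posOf : ∀ xs v → v ∈ xs → at xs (posOf xs v) ≡ v
at-posOf (x ∷ xs) v v∈ with x ℕ.≟ v
... | yes refl rewrite posOf-head x xs = refl
... | no x≢v with v∈
...   | here v≡x  = ⊥-elim (x≢v (sym v≡x))
...   | there v∈′ rewrite posOf-∷ x xs v x≢v v∈′ =
  trans (at-cons x xs (posOf xs v) (posOf-positive xs v v∈′)) (at-posOf xs v v∈′)

posOf-injective : ∀ xs u v → u ∈ xs → v ∈ xs → u ≢ v → posOf xs u ≢ posOf xs v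
posOf-injective xs u v u∈ v∈ u≢v e = u≢v (trans (sym (at-posOf xs u u∈)) (trans (cong (at xs) e) (at-posOf xs v v∈)))

posOf-++ : ∀ ys zs v → v ∈ ys → posOf (ys ++ zs) v ≡ posOf ys v
posOf-++ (y ∷ ys) zs v v∈ with y ℕ.≟ v
... | yes refl rewrite posOf-head y (ys ++ zs) | posOf-head y ys = refl
... | no y≢v with v∈
...   | here v≡y  = ⊥-elim (y≢v (sym v≡y))
...   | there v∈′ rewrite posOf-∷ y ys v y≢v v∈′ | posOf-∷ y (ys ++ zs) v y≢v (∈-++⁺ˡ v∈′) =
  cong suc (posOf-++ ys zs v v∈′)

posOf-∷ʳ : ∀ ys x → x ∉ ys → posOf (ys ++ [ x ]) x ≡ suc (length ys)
posOf-∷ʳ []       x _  = posOf-head x []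
posOf-∷ʳ (y ∷ ys) x x∉ rewrite posOf-∷ y (ys ++ [ x ]) x (λ y≡x → x∉ (here (sym y≡x))) (∈-++⁺ʳ ys (here refl)) =
  cong suc (posOf-∷ʳ ys x (λ x∈ → x∉ (there x∈)))

posOf-reverse : ∀ xs v → Unique xs → v ∈ xs → posOf (reverse xs) v + posOf xs v ≡ suc (length xs)
posOf-reverse (x ∷ xs) v (x∉ ∷ u) v∈ rewrite unfold-reverse x xs with x ℕ.≟ v
... | yes refl rewrite posOf-∷ʳ (reverse xs) x (λ x∈ → All.lookup x∉ (∈-resp-↭ (↭-reverse xs) x∈) refl)
                     | posOf-head x xs | length-reverse xs = +-comm (suc (length xs)) 1
... | no x≢v with v∈
...   | here v≡x  = ⊥-elim (x≢v (sym v≡x))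
...   | there v∈′ rewrite posOf-++ (reverse xs) [ x ] v (∈-resp-↭ (↭-sym (↭-reverse xs)) v∈′) | posOf-∷ x xs v x≢v v∈′ =
  trans (+-suc (posOf (reverse xs) v) (posOf xs v)) (cong suc (posOf-reverse xs v u v∈′))

posOf-map : ∀ (f : ℕ → ℕ) xs v → (∀ x → x ∈ xs → (f x ≡ᵇ v) ≡ (x ≡ᵇ f v)) → posOf (map f xs) v ≡ posOf xs (f v)
posOf-map f []       v _     = refl
posOf-map f (x ∷ xs) v f≡ᵇv rewrite f≡ᵇv x (here refl) | posOf-map f xs v (λ y y∈ → f≡ᵇv y (there y∈)) = refl

recoilsN≡∑ : ∀ σ → recoilsN σ ≡ ∑ (oneTo (length σ ∸ 1)) (λ i → toℕ (posOf σ (suc i) <ᵇ posOf σ i))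
recoilsN≡∑ σ = countB≡∑ _ (oneTo (length σ ∸ 1))

module _ {n σ} (p : Perm n σ) (1≤n : 1 ≤ n) where
  open Arrangement (arrangement p)

  private
    ∈σ : ∀ v → 1 ≤ v → v ≤ n → v ∈ σ
    ∈σ (suc v) _ (s≤s v≤) = ∈-resp-↭ (↭-sym p) (∈-map⁺ suc (∈-upTo⁺ (s≤s v≤)))

    suc≤n : ∀ i → 1 ≤ i → i ≤ n ∸ 1 → suc i ≤ n
    suc≤n i 1≤i i≤ = subst (_≤ n) (+-comm i 1) (m≤o∸n⇒m+n≤o i 1≤n i≤)

    posOf≤ : ∀ v → v ∈ σ → posOf σ v ≤ suc n
    posOf≤ v v∈ = m≤n⇒m≤1+n (subst (posOf σ v ≤_) length≡ (posOf≤length σ v v∈))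

    recoil+nonRecoil : ∀ i → 1 ≤ i → i ≤ n ∸ 1 → ∀ {b} → b ≡ (posOf σ i <ᵇ posOf σ (suc i)) →
      toℕ (posOf σ (suc i) <ᵇ posOf σ i) + toℕ b ≡ 1
    recoil+nonRecoil i 1≤i i≤ refl = <ᵇ-+-swap (posOf-injective σ (suc i) i
      (∈σ (suc i) (s≤s z≤n) (suc≤n i 1≤i i≤)) (∈σ i 1≤i (≤-trans (n≤1+n i) (suc≤n i 1≤i i≤))) (λ i+1≡i → <-irrefl (sym i+1≡i) ≤-refl))

    posOf-revMap : ∀ v → v ∈ σ → posOf (revMap σ) v ≡ suc n ∸ posOf σ v
    posOf-revMap v v∈ = trans (sym (m+n∸n≡m (posOf (reverse σ) v) (posOf σ v)))
      (cong (_∸ posOf σ v) (trans (posOf-reverse σ v unique v∈) (cong suc length≡)))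

    posOf-compMap : ∀ v → v ≤ n → posOf (compMap n σ) v ≡ posOf σ (suc n ∸ v)
    posOf-compMap v v≤n = posOf-map (suc n ∸_) σ v (λ x x∈ → complement-≡ᵇ (m≤n⇒m≤1+n (proj₂ (∈-range x x∈))) (m≤n⇒m≤1+n v≤n))
      where
      complement-≡ᵇ : ∀ {x v} → x ≤ suc n → v ≤ suc n → (suc n ∸ x ≡ᵇ v) ≡ (x ≡ᵇ suc n ∸ v)
      complement-≡ᵇ {x} {v} x≤ v≤ = T-ext
        (λ t → ≡⇒≡ᵇ x (suc n ∸ v) (trans (sym (m∸[m∸n]≡n x≤)) (cong (suc n ∸_) (≡ᵇ⇒≡ (suc n ∸ x) v t))))
        (λ t → ≡⇒≡ᵇ (suc n ∸ x) v (trans (cong (suc n ∸_) (≡ᵇ⇒≡ x (suc n ∸ v) t)) (m∸[m∸n]≡n v≤)))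

  recoils-revMap : recoilsN σ + recoilsN (revMap σ) ≡ n ∸ 1
  recoils-revMap rewrite recoilsN≡∑ σ | recoilsN≡∑ (revMap σ) | length-revMap (arrangement p) | length≡ =
    ∑-oneTo-complementary (n ∸ 1) _ _ (λ i 1≤i i≤ →
      let i∈  = ∈σ i 1≤i (≤-trans (n≤1+n i) (suc≤n i 1≤i i≤))
          i+1∈ = ∈σ (suc i) (s≤s z≤n) (suc≤n i 1≤i i≤)
      in recoil+nonRecoil i 1≤i i≤ (trans (cong₂ _<ᵇ_ (posOf-revMap (suc i) i+1∈) (posOf-revMap i i∈))
                                          (∸-<ᵇ-∸ (suc n) (posOf≤ (suc i) i+1∈) (posOf≤ i i∈))))

  recoils-compMap : recoilsN σ + recoilsN (compMap n σ) ≡ n ∸ 1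
  recoils-compMap rewrite recoilsN≡∑ σ | recoilsN≡∑ (compMap n σ) | length-compMap (arrangement p) | length≡ = begin
    ∑ O recoil + ∑ O (λ j → toℕ (posOf (compMap n σ) (suc j) <ᵇ posOf (compMap n σ) j))
      ≡⟨ cong (λ s → ∑ O recoil + s) (∑-oneTo-cong (n ∸ 1) (λ j 1≤j j≤ → cong₂ (λ u v → toℕ (u <ᵇ v))
           (posOf-compMap (suc j) (suc≤n j 1≤j j≤)) (posOf-compMap j (≤-trans (n≤1+n j) (suc≤n j 1≤j j≤))))) ⟩
    ∑ O recoil + ∑ O (λ j → toℕ (posOf σ (suc n ∸ suc j) <ᵇ posOf σ (suc n ∸ j)))
      ≡⟨ cong (λ s → ∑ O recoil + s) (∑-oneTo-reflect (n ∸ 1) _) ⟩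
    ∑ O recoil + ∑ O (λ i → toℕ (posOf σ (n ∸ (suc (n ∸ 1) ∸ i)) <ᵇ posOf σ (suc n ∸ (suc (n ∸ 1) ∸ i))))
      ≡⟨ ∑-oneTo-complementary (n ∸ 1) _ _ (λ i 1≤i i≤ → recoil+nonRecoil i 1≤i i≤
           (cong₂ (λ u v → posOf σ u <ᵇ posOf σ v) (reflect₁ i (i≤n i 1≤i i≤)) (reflect₂ i (i≤n i 1≤i i≤)))) ⟩
    n ∸ 1 ∎
    where
    open ≡-Reasoning
    O = oneTo (n ∸ 1)
    recoil : ℕ → ℕ
    recoil i = toℕ (posOf σ (suc i) <ᵇ posOf σ i)
    i≤n : ∀ i → 1 ≤ i → i ≤ n ∸ 1 → i ≤ n
    i≤n i 1≤i i≤ = ≤-trans (n≤1+n i) (suc≤n i 1≤i i≤)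
    1+[n∸1]≡n : suc (n ∸ 1) ≡ n
    1+[n∸1]≡n = m+[n∸m]≡n 1≤n
    reflect₁ : ∀ i → i ≤ n → n ∸ (suc (n ∸ 1) ∸ i) ≡ i
    reflect₁ i i≤n = trans (cong (λ m → n ∸ (m ∸ i)) 1+[n∸1]≡n) (m∸[m∸n]≡n i≤n)
    reflect₂ : ∀ i → i ≤ n → suc n ∸ (suc (n ∸ 1) ∸ i) ≡ suc i
    reflect₂ i i≤n = trans (cong (λ m → suc n ∸ (m ∸ i)) 1+[n∸1]≡n)
      (trans (+-∸-assoc 1 (m∸n≤m n i)) (cong suc (m∸[m∸n]≡n i≤n)))

recoils-balanced : ∀ n → 1 ≤ n → Balanced n recoils
recoils-balanced n 1≤n = pairSumℕ (λ σ p → recoils-revMap p 1≤n) , pairSumℕ (λ σ p → recoils-compMap p 1≤n)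

-- Patterns of length three: (20)

Triple : Set
Triple = ℕ × ℕ × ℕ

tripleSum : ℕ → (Triple → ℕ) → ℕ
tripleSum n h = ∑ (oneTo n) (λ i → ∑ (oneTo n) (λ j → ∑ (oneTo n) (λ k →
  if i <ᵇ j then (if j <ᵇ k then h (i , j , k) else 0) else 0)))

∑-posTriples : ∀ n (h : Triple → ℕ) → ∑ (posTriples n) h ≡ tripleSum n h
∑-posTriples n h = begin
  ∑ (posTriples n) h
    ≡⟨ ∑-filter (λ t → proj₁ t ℕ.<? proj₁ (proj₂ t)) (concatMap extend (posPairs n)) h ⟩
  ∑ (concatMap extend (posPairs n)) h′
    ≡⟨ ∑-concatMap extend (posPairs n) h′ ⟩
  ∑ (posPairs n) (λ p → ∑ (extend p) h′)
    ≡⟨ ∑-cong (posPairs n) (λ p _ → trans (∑-map (filter (λ k → proj₂ p ℕ.<? k) (oneTo n)) (λ k → proj₁ p , proj₂ p , k) h′)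
                                         (∑-filter (λ k → proj₂ p ℕ.<? k) (oneTo n) (λ k → h′ (proj₁ p , proj₂ p , k)))) ⟩
  ∑ (posPairs n) (λ p → ∑ (oneTo n) (λ k → if proj₂ p <ᵇ k then h′ (proj₁ p , proj₂ p , k) else 0))
    ≡⟨ ∑-posPairs n _ ⟩
  ∑ (oneTo n) (λ i → ∑ (oneTo n) (λ j → if i <ᵇ j then ∑ (oneTo n) (λ k → if j <ᵇ k then h′ (i , j , k) else 0) else 0))
    ≡⟨ ∑-cong (oneTo n) (λ i _ → ∑-cong (oneTo n) (λ j _ →
         trans (∑-if (oneTo n) (i <ᵇ j) _) (∑-cong (oneTo n) (λ k _ → redundant (i <ᵇ j) (j <ᵇ k) (h (i , j , k)))))) ⟩
  tripleSum n h ∎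
  where
  open ≡-Reasoning
  extend : ℕ × ℕ → List Triple
  extend p = map (λ k → proj₁ p , proj₂ p , k) (filter (λ k → proj₂ p ℕ.<? k) (oneTo n))
  h′ : Triple → ℕ
  h′ t = if proj₁ t <ᵇ proj₁ (proj₂ t) then h t else 0
  redundant : ∀ b c v → (if b then (if c then (if b then v else 0) else 0) else 0) ≡ (if b then (if c then v else 0) else 0)
  redundant true  c v = refl
  redundant false c v = refl

tripleSum-cong : ∀ n {f g : Triple → ℕ} → (∀ i j k → 1 ≤ i → i < j → j < k → k ≤ n → f (i , j , k) ≡ g (i , j , k)) →
  tripleSum n f ≡ tripleSum n g
tripleSum-cong n {f} {g} f≗g = ∑-oneTo-cong n (λ i 1≤i _ → ∑-oneTo-cong n (λ j _ _ → ∑-oneTo-cong n (λ k _ k≤n → term i j k 1≤i k≤n)))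
  where
  term : ∀ i j k → 1 ≤ i → k ≤ n →
    (if i <ᵇ j then (if j <ᵇ k then f (i , j , k) else 0) else 0) ≡ (if i <ᵇ j then (if j <ᵇ k then g (i , j , k) else 0) else 0)
  term i j k 1≤i k≤n with i <ᵇ j in i<j | j <ᵇ k in j<k
  ... | true  | true  = f≗g i j k 1≤i (<ᵇ⇒< i j (subst T (sym i<j) _)) (<ᵇ⇒< j k (subst T (sym j<k) _)) k≤n
  ... | true  | false = refl
  ... | false | _     = refl

tripleSum-+ : ∀ n (f g : Triple → ℕ) → tripleSum n f + tripleSum n g ≡ tripleSum n (λ t → f t + g t)
tripleSum-+ n f g = trans (∑-+ (oneTo n) _ _) (∑-cong (oneTo n) (λ i _ → trans (∑-+ (oneTo n) _ _) (∑-cong (oneTo n) (λ j _ →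
  trans (∑-+ (oneTo n) _ _) (∑-cong (oneTo n) (λ k _ → term (i <ᵇ j) (j <ᵇ k) (f (i , j , k)) (g (i , j , k))))))))
  where
  term : ∀ b c u v → (if b then (if c then u else 0) else 0) + (if b then (if c then v else 0) else 0) ≡ (if b then (if c then u + v else 0) else 0)
  term true  true  u v = refl
  term true  false u v = refl
  term false c     u v = refl

reflectTriple : ℕ → Triple → Triple
reflectTriple n t = suc n ∸ proj₂ (proj₂ t) , suc n ∸ proj₁ (proj₂ t) , suc n ∸ proj₁ t

tripleSum-reflect : ∀ n (h : Triple → ℕ) → tripleSum n h ≡ tripleSum n (λ t → h (reflectTriple n t))
tripleSum-reflect n h = begin
  tripleSum n h
    ≡⟨ ∑-oneTo-reflect n _ ⟩
  ∑ O (λ i → ∑ O (λ j → ∑ O (λ k → F (N ∸ i) j k)))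
    ≡⟨ ∑-oneTo-cong n (λ i _ _ → ∑-oneTo-reflect n _) ⟩
  ∑ O (λ i → ∑ O (λ j → ∑ O (λ k → F (N ∸ i) (N ∸ j) k)))
    ≡⟨ ∑-oneTo-cong n (λ i _ _ → ∑-oneTo-cong n (λ j _ _ → ∑-oneTo-reflect n _)) ⟩
  ∑ O (λ i → ∑ O (λ j → ∑ O (λ k → F (N ∸ i) (N ∸ j) (N ∸ k))))
    ≡⟨ ∑-oneTo-cong n (λ i _ i≤n → ∑-oneTo-cong n (λ j _ j≤n → ∑-oneTo-cong n (λ k _ k≤n →
         cong₂ (λ b c → if b then (if c then h (N ∸ i , N ∸ j , N ∸ k) else 0) else 0)
           (∸-<ᵇ-∸ N (m≤n⇒m≤1+n i≤n) (m≤n⇒m≤1+n j≤n)) (∸-<ᵇ-∸ N (m≤n⇒m≤1+n j≤n) (m≤n⇒m≤1+n k≤n))))) ⟩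
  ∑ O (λ i → ∑ O (λ j → ∑ O (λ k → G i j k)))
    ≡⟨ ∑-cong O (λ i _ → ∑-swap O O _) ⟩
  ∑ O (λ i → ∑ O (λ k → ∑ O (λ j → G i j k)))
    ≡⟨ ∑-swap O O _ ⟩
  ∑ O (λ k → ∑ O (λ i → ∑ O (λ j → G i j k)))
    ≡⟨ ∑-cong O (λ k _ → ∑-swap O O _) ⟩
  ∑ O (λ k → ∑ O (λ j → ∑ O (λ i → G i j k)))
    ≡⟨ ∑-cong O (λ k _ → ∑-cong O (λ j _ → ∑-cong O (λ i _ → if-comm (j <ᵇ i) (k <ᵇ j) _))) ⟩
  tripleSum n (λ t → h (reflectTriple n t)) ∎
  where
  open ≡-Reasoning
  O = oneTo n
  N = suc n
  F : ℕ → ℕ → ℕ → ℕ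
  F i j k = if i <ᵇ j then (if j <ᵇ k then h (i , j , k) else 0) else 0
  G : ℕ → ℕ → ℕ → ℕ
  G i j k = if j <ᵇ i then (if k <ᵇ j then h (N ∸ i , N ∸ j , N ∸ k) else 0) else 0
  if-comm : ∀ b c v → (if b then (if c then v else 0) else 0) ≡ (if c then (if b then v else 0) else 0)
  if-comm true  true  v = refl
  if-comm true  false v = refl
  if-comm false true  v = refl
  if-comm false false v = refl

-- A triple of distinct values is described by the comparisons x < y, x < z, y < z;
-- patterns 132, 213 and 321 are (T,T,F), (F,T,T) and (F,F,F).
patternIndicator : Bool → Bool → Bool → ℕ
patternIndicator b₁ b₂ b₃ =
  toℕ ((b₁ ⇔ᵇ true) ∧ (b₂ ⇔ᵇ true) ∧ (b₃ ⇔ᵇ false)) +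
  toℕ ((b₁ ⇔ᵇ false) ∧ (b₂ ⇔ᵇ true) ∧ (b₃ ⇔ᵇ true)) +
  toℕ ((b₁ ⇔ᵇ false) ∧ (b₂ ⇔ᵇ false) ∧ (b₃ ⇔ᵇ false))

patternCount : ℕ → ℕ → ℕ → ℕ
patternCount x y z =
  toℕ (sameOrder (x , y , z) (1 , 3 , 2)) + toℕ (sameOrder (x , y , z) (2 , 1 , 3)) + toℕ (sameOrder (x , y , z) (3 , 2 , 1))

Transitive : Bool → Bool → Bool → Set
Transitive b₁ b₂ b₃ = (b₁ ≡ true → b₃ ≡ true → b₂ ≡ true) × (b₁ ≡ false → b₃ ≡ false → b₂ ≡ false)

-- Complementing a pattern negates all three comparisons and reversing it also reverses their order;
-- either way 132, 213, 321 go to 312, 231, 123 or to 231, 312, 123, the other three patterns.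
patternIndicator-complement : ∀ b₁ b₂ b₃ → Transitive b₁ b₂ b₃ →
  patternIndicator b₁ b₂ b₃ + patternIndicator (not b₁) (not b₂) (not b₃) ≡ 1
patternIndicator-complement true  true  true  _ = refl
patternIndicator-complement true  true  false _ = refl
patternIndicator-complement true  false true  (tr , _) with () ← tr refl refl
patternIndicator-complement true  false false _ = refl
patternIndicator-complement false true  true  _ = refl
patternIndicator-complement false true  false (_ , tr) with () ← tr refl refl
patternIndicator-complement false false true  _ = refl
patternIndicator-complement false false false _ = refl

patternIndicator-reverse : ∀ b₁ b₂ b₃ → Transitive b₁ b₂ b₃ →
  patternIndicator b₁ b₂ b₃ + patternIndicator (not b₃) (not b₂) (not b₁) ≡ 1
patternIndicator-reverse true  true  true  _ = refl
patternIndicator-reverse true  true  false _ = refl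
patternIndicator-reverse true  false true  (tr , _) with () ← tr refl refl
patternIndicator-reverse true  false false _ = refl
patternIndicator-reverse false true  true  _ = refl
patternIndicator-reverse false true  false (_ , tr) with () ← tr refl refl
patternIndicator-reverse false false true  _ = refl
patternIndicator-reverse false false false _ = refl

<ᵇ-transitive : ∀ x y z → x ≢ y → y ≢ z → Transitive (x <ᵇ y) (x <ᵇ z) (y <ᵇ z)
<ᵇ-transitive x y z x≢y y≢z =
  (λ x<y y<z → <ᵇ-true (<-trans (<ᵇ⇒< x y (subst T (sym x<y) _)) (<ᵇ⇒< y z (subst T (sym y<z) _)))) ,
  (λ x≮y y≮z → <ᵇ-false {x} {z} (≤-trans (≮⇒≥ (¬< {y} {z} y≮z)) (≮⇒≥ (¬< {x} {y} x≮y))))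
  where
  ¬< : ∀ {a b} → (a <ᵇ b) ≡ false → ¬ a < b
  ¬< a≮b a<b = subst T a≮b (<⇒<ᵇ a<b)

patternCount-complement : ∀ N x y z → x ≤ N → y ≤ N → z ≤ N → x ≢ y → y ≢ z → x ≢ z →
  patternCount x y z + patternCount (N ∸ x) (N ∸ y) (N ∸ z) ≡ 1
patternCount-complement N x y z x≤ y≤ z≤ x≢y y≢z x≢z
  rewrite ∸-<ᵇ-∸ N x≤ y≤ | ∸-<ᵇ-∸ N x≤ z≤ | ∸-<ᵇ-∸ N y≤ z≤ | <ᵇ-swap x≢y | <ᵇ-swap x≢z | <ᵇ-swap y≢z =
  patternIndicator-complement (x <ᵇ y) (x <ᵇ z) (y <ᵇ z) (<ᵇ-transitive x y z x≢y y≢z)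

patternCount-reverse : ∀ x y z → x ≢ y → y ≢ z → x ≢ z → patternCount x y z + patternCount z y x ≡ 1
patternCount-reverse x y z x≢y y≢z x≢z rewrite <ᵇ-swap x≢y | <ᵇ-swap x≢z | <ᵇ-swap y≢z =
  patternIndicator-reverse (x <ᵇ y) (x <ᵇ z) (y <ᵇ z) (<ᵇ-transitive x y z x≢y y≢z)

patternsAt : List ℕ → Triple → ℕ
patternsAt τ t = patternCount (at τ (proj₁ t)) (at τ (proj₁ (proj₂ t))) (at τ (proj₂ (proj₂ t)))

patterns≡tripleSum : ∀ σ → patterns132-213-321 σ ≡ + tripleSum (length σ) (patternsAt σ)
patterns≡tripleSum σ = cong +_ (begin
  occurrences (1 , 3 , 2) σ + occurrences (2 , 1 , 3) σ + occurrences (3 , 2 , 1) σ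
    ≡⟨ cong₂ _+_ (cong₂ _+_ (countB≡∑ (is (1 , 3 , 2)) Ts) (countB≡∑ (is (2 , 1 , 3)) Ts)) (countB≡∑ (is (3 , 2 , 1)) Ts) ⟩
  ∑ Ts (toℕ ∘ is (1 , 3 , 2)) + ∑ Ts (toℕ ∘ is (2 , 1 , 3)) + ∑ Ts (toℕ ∘ is (3 , 2 , 1))
    ≡⟨ trans (cong (_+ ∑ Ts (toℕ ∘ is (3 , 2 , 1))) (∑-+ Ts _ _)) (∑-+ Ts _ _) ⟩
  ∑ Ts (patternsAt σ)
    ≡⟨ ∑-posTriples (length σ) (patternsAt σ) ⟩
  tripleSum (length σ) (patternsAt σ) ∎)
  where
  open ≡-Reasoning
  Ts = posTriples (length σ)
  is : Triple → Triple → Bool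
  is pat t = sameOrder (at σ (proj₁ t) , at σ (proj₁ (proj₂ t)) , at σ (proj₂ (proj₂ t))) pat

module _ {n σ} (g : Arrangement n σ) where
  open Arrangement g

  private
    module Increasing {i j k} (1≤i : 1 ≤ i) (i<j : i < j) (j<k : j < k) (k≤n : k ≤ n) where
      j≤n = ≤-trans (<⇒≤ j<k) k≤n
      i≤n = ≤-trans (<⇒≤ i<j) j≤n
      1≤j = ≤-trans 1≤i (<⇒≤ i<j)
      1≤k = ≤-trans 1≤j (<⇒≤ j<k)
      σi≢σj = at-inj i j 1≤i i≤n 1≤j j≤n (λ i≡j → <-irrefl i≡j i<j)
      σj≢σk = at-inj j k 1≤j j≤n 1≤k k≤n (λ j≡k → <-irrefl j≡k j<k)
      σi≢σk = at-inj i k 1≤i i≤n 1≤k k≤n (λ i≡k → <-irrefl i≡k (<-trans i<j j<k))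

    total : ∀ τ → length τ ≡ n → tripleSum n (patternsAt σ) + tripleSum n (patternsAt τ) ≡ tripleSum n (λ _ → 1) →
      patterns132-213-321 σ ℤ.+ patterns132-213-321 τ ≡ + tripleSum n (λ _ → 1)
    total τ lenτ sum = trans (cong₂ ℤ._+_ (patterns≡tripleSum σ) (patterns≡tripleSum τ))
      (cong +_ (trans (cong₂ (λ l m → tripleSum l (patternsAt σ) + tripleSum m (patternsAt τ)) length≡ lenτ) sum))

  patterns-compMap : patterns132-213-321 σ ℤ.+ patterns132-213-321 (compMap n σ) ≡ + tripleSum n (λ _ → 1)
  patterns-compMap = total (compMap n σ) (length-compMap g) (trans (tripleSum-+ n _ _) (tripleSum-cong n (λ i j k 1≤i i<j j<k k≤n →
    let open Increasing 1≤i i<j j<k k≤n in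
    trans (cong₂ (λ u v → patternCount (at σ i) (at σ j) (at σ k) + patternCount u v (at (compMap n σ) k))
                 (at-compMap g i 1≤i i≤n) (at-compMap g j 1≤j j≤n))
    (trans (cong (λ w → patternCount (at σ i) (at σ j) (at σ k) + patternCount (suc n ∸ at σ i) (suc n ∸ at σ j) w)
                 (at-compMap g k 1≤k k≤n))
    (patternCount-complement (suc n) (at σ i) (at σ j) (at σ k)
      (at≤1+n i 1≤i i≤n) (at≤1+n j 1≤j j≤n) (at≤1+n k 1≤k k≤n) σi≢σj σj≢σk σi≢σk)))))

  patterns-revMap : patterns132-213-321 σ ℤ.+ patterns132-213-321 (revMap σ) ≡ + tripleSum n (λ _ → 1)
  patterns-revMap = total (revMap σ) (length-revMap g) (begin
    tripleSum n (patternsAt σ) + tripleSum n (patternsAt (revMap σ))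
      ≡⟨ cong (λ s → tripleSum n (patternsAt σ) + s) (tripleSum-reflect n _) ⟩
    tripleSum n (patternsAt σ) + tripleSum n (λ t → patternsAt (revMap σ) (reflectTriple n t))
      ≡⟨ cong (λ s → tripleSum n (patternsAt σ) + s) (tripleSum-cong n (λ i j k 1≤i i<j j<k k≤n →
           let open Increasing 1≤i i<j j<k k≤n in
           trans (cong₂ (λ u w → patternCount u w (at (revMap σ) (suc n ∸ i))) (reflected k 1≤k k≤n) (reflected j 1≤j j≤n))
                 (cong (patternCount (at σ k) (at σ j)) (reflected i 1≤i i≤n)))) ⟩
    tripleSum n (patternsAt σ) + tripleSum n (λ t → patternCount (at σ (proj₂ (proj₂ t))) (at σ (proj₁ (proj₂ t))) (at σ (proj₁ t)))
      ≡⟨ tripleSum-+ n _ _ ⟩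
    tripleSum n (λ t → patternsAt σ t + patternCount (at σ (proj₂ (proj₂ t))) (at σ (proj₁ (proj₂ t))) (at σ (proj₁ t)))
      ≡⟨ tripleSum-cong n (λ i j k 1≤i i<j j<k k≤n → let open Increasing 1≤i i<j j<k k≤n in
           patternCount-reverse (at σ i) (at σ j) (at σ k) σi≢σj σj≢σk σi≢σk) ⟩
    tripleSum n (λ _ → 1) ∎)
    where
    open ≡-Reasoning
    reflected : ∀ m → 1 ≤ m → m ≤ n → at (revMap σ) (suc n ∸ m) ≡ at σ m
    reflected m 1≤m m≤n = trans (at-revMap g (suc n ∸ m) (m<n⇒0<n∸m (s≤s m≤n)) (∸-monoʳ-≤ (suc n) 1≤m))
      (cong (at σ) (m∸[m∸n]≡n (m≤n⇒m≤1+n m≤n)))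

patterns-balanced : ∀ n → Balanced n patterns132-213-321
patterns-balanced n = pairSumIs _ (λ σ p → patterns-revMap (arrangement p)) , pairSumIs _ (λ σ p → patterns-compMap (arrangement p))

runs-balanced : ∀ n → 1 ≤ n → Balanced n runs
runs-balanced n 1≤n = Balanced-resp (λ σ p → sym (runs≡ p 1≤n)) (Balanced-affine (+ 1) (+ 1) (descentsAt-balanced n 1 ≤-refl))

treeWidth-balanced : ∀ n → 1 ≤ n → Balanced n treeWidth
treeWidth-balanced n 1≤n = Balanced-resp (λ σ p → sym (treeWidth≡ p 1≤n)) (Balanced-affine (+ 1) (+ 1) (descentsAt-balanced n 1 ≤-refl))

statistics-balanced : ∀ n → 1 ≤ n → All (Balanced n) statistics
statistics-balanced n 1≤n =
    inversions-balanced n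
  ∷ inversionSum-balanced n
  ∷ nonInversions-balanced n
  ∷ nonInversionSum-balanced n
  ∷ inversionsWithDistance-balanced n (_≤ᵇ 3)
  ∷ inversionsWithDistance-balanced n (_≤ᵇ 2)
  ∷ inversionsWithDistance-balanced n isEven
  ∷ inversionsWithDistance-balanced n (not ∘ isEven)
  ∷ biAltInversions-balanced n
  ∷ descentsAt-balanced n 1 (s≤s z≤n)
  ∷ ascentsAt-balanced n 1 (s≤s z≤n)
  ∷ runs-balanced n 1≤n
  ∷ Balanced-+ (descentsAt-balanced n 1 (s≤s z≤n)) (wrap-balanced n 1≤n)
  ∷ descentsAt-balanced n 2 (s≤s z≤n)
  ∷ ascentsAt-balanced n 2 (s≤s z≤n)
  ∷ descentsAt-balanced n 3 (s≤s z≤n)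
  ∷ treeWidth-balanced n 1≤n
  ∷ cosine-balanced n
  ∷ recoils-balanced n 1≤n
  ∷ patterns-balanced n
  ∷ Balanced-+ (descentsAt-balanced n 1 (s≤s z≤n)) (recoils-balanced n 1≤n)
  ∷ spearmanRho-balanced n
  ∷ []

theorem5p4 : ∀ (n : ℕ) → 1 ≤ n →
    All (λ f → Homomesic (Perm n) revMap f × Homomesic (Perm n) (compMap n) f) statistics
theorem5p4 n 1≤n = All.map (Balanced⇒homomesic n) (statistics-balanced n 1≤n)
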